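{- Let $G$ be a connected chordal graph. The following are equivalent: (i) $G$ has a dominating clique; (ii) $\mathrm{diam}(G)\le 3$; (iii) $G\in \mathcal{G}^{\mathrm{cs}}$.
   Context: All graphs are finite and simple. A weight function on $V(G)$ is a map $w:V(G)\to\mathbb{R}_{>0}$; for $X\subseteq V(G)$ put $w(X)=\sum_{v\in X}w(v)$. A non-empty set $S\subseteq V(G)$ is a weighted safe set of $(G,w)$ if for every component $C$ of the induced subgraph $G[S]$ and every component $D$ of $G-S$ such that some edge joins $C$ and $D$, we have $w(C)\ge w(D)$. It is a connected weighted safe set if moreover $G[S]$ is connected. $\mathrm{s}(G,w)$ (resp. $\mathrm{cs}(G,w)$) is the minimum of $w(S)$ over all weighted safe sets (resp. connected weighted safe sets) $S$ of $(G,w)$. $\mathcal{G}^{\mathrm{cs}}$ denotes the family of all graphs $G$ such that $\mathrm{s}(G,w)=\mathrm{cs}(G,w)$ for every weight function $w$ on $V(G)$. A dominating clique is a set of vertices inducing a complete graph such that every vertex outside it has a neighbor in it.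
   Formalization: In the definition of $\mathcal{G}^{\mathrm{cs}}$ the weight functions take values in the positive rationals rather than in $\mathbb{R}_{>0}$. -}

module Defs where

open import Data.Nat as ℕ using (ℕ; zero; suc; _≥_)
open import Data.Fin using (Fin; toℕ) renaming (zero to fzero; suc to fsuc)
open import Data.Bool using (Bool; true; false; if_then_else_)
open import Data.Fin.Subset using (Subset; _∈_; _∉_; ∁)
open import Data.Vec using (lookup)
open import Data.Rational using (ℚ; 0ℚ; _+_; _≤_; _<_)
open import Data.Product using (Σ; ∃; ∃-syntax; _×_; _,_)
open import Data.Sum using (_⊎_)
open import Relation.Binary.PropositionalEquality using (_≡_; _≢_)
open import Relation.Nullary using (¬_)
open import Function.Definitions using (Injective)

record Graph (n : ℕ) : Set where
  field
    adj    : Fin n → Fin n → Bool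
    sym    : ∀ x y → adj x y ≡ adj y x
    irrefl : ∀ x → adj x x ≡ false

module _ {n : ℕ} (G : Graph n) where

  E : Fin n → Fin n → Set
  E x y = Graph.adj G x y ≡ true

  data Walk : ℕ → Fin n → Fin n → Set where
    nil  : ∀ {x} → Walk 0 x x
    cons : ∀ {l x y z} → E x y → Walk l y z → Walk (suc l) x z

  Connected : Set
  Connected = ∀ x y → ∃[ l ] Walk l x y

  DiamAtMost3 : Set
  DiamAtMost3 = ∀ x y → ∃[ l ] (l ℕ.≤ 3 × Walk l x y)

  data PathIn (S : Subset n) : Fin n → Fin n → Set where
    here : ∀ {x} → x ∈ S → PathIn S x x
    step : ∀ {x y z} → x ∈ S → E x y → PathIn S y z → PathIn S x z

  IsComponent : Subset n → Subset n → Set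
  IsComponent S C =
    (∃[ x ] x ∈ C)
    × (∀ x → x ∈ C → x ∈ S)
    × (∀ x y → x ∈ C → y ∈ C → PathIn C x y)
    × (∀ x y → x ∈ C → y ∈ S → E x y → y ∈ C)

  Clique : Subset n → Set
  Clique K = ∀ x y → x ∈ K → y ∈ K → x ≢ y → E x y

  IsDominatingClique : Subset n → Set
  IsDominatingClique K = Clique K × (∀ v → v ∉ K → ∃[ u ] (u ∈ K × E u v))

  HasDominatingClique : Set
  HasDominatingClique = ∃[ K ] IsDominatingClique K

  -- cycle adjacency on positions 0,…,k-1 of a cycle of length k
  CycNext : (k : ℕ) → Fin k → Fin k → Set
  CycNext k i j = (toℕ j ≡ suc (toℕ i)) ⊎ ((suc (toℕ i) ≡ k) × (toℕ j ≡ 0))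

  IsInducedCycle : (k : ℕ) → (Fin k → Fin n) → Set
  IsInducedCycle k f =
    Injective _≡_ _≡_ f
    × (∀ i j → CycNext k i j → E (f i) (f j))
    × (∀ i j → E (f i) (f j) → CycNext k i j ⊎ CycNext k j i)

  -- chordal: every cycle of length at least 4 has a chord,
  -- i.e. there is no induced cycle of length at least 4
  Chordal : Set
  Chordal = ∀ k → k ≥ 4 → (f : Fin k → Fin n) → ¬ IsInducedCycle k f

sumFin : ∀ {n} → (Fin n → ℚ) → ℚ
sumFin {zero}  f = 0ℚ
sumFin {suc n} f = f fzero + sumFin (λ i → f (fsuc i))

wt : ∀ {n} → (Fin n → ℚ) → Subset n → ℚ
wt w X = sumFin (λ v → if lookup X v then w v else 0ℚ)

PositiveWeight : ∀ {n} → (Fin n → ℚ) → Set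
PositiveWeight w = ∀ v → 0ℚ < w v

module _ {n : ℕ} (G : Graph n) (w : Fin n → ℚ) where

  IsSafe : Subset n → Set
  IsSafe S =
    (∃[ x ] x ∈ S)
    × (∀ C D → IsComponent G S C → IsComponent G (∁ S) D
         → (∃[ x ] ∃[ y ] (x ∈ C × y ∈ D × E G x y))
         → wt w D ≤ wt w C)

  IsConnSafe : Subset n → Set
  IsConnSafe S = IsSafe S × (∀ x y → x ∈ S → y ∈ S → PathIn G S x y)

IsMinWeight : ∀ {n} → (Fin n → ℚ) → (Subset n → Set) → ℚ → Set
IsMinWeight w P m = (∃[ S ] (P S × wt w S ≡ m)) × (∀ S → P S → m ≤ wt w S)

-- G ∈ 𝒢^cs : s(G,w) = cs(G,w) for every (positive) weight function w
InGcs : ∀ {n} → Graph n → Set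
InGcs G = ∀ w → PositiveWeight w → ∀ s cs
  → IsMinWeight w (IsSafe G w) s → IsMinWeight w (IsConnSafe G w) cs → s ≡ cs

module Submission where

-- (i) ⇒ (ii): walk to the clique, across it, and out.  (ii) ⇒ (i): enlarge a clique K until it
-- dominates everything.  If y is not dominated, replace K by its vertices adjacent to the component
-- C of y in G − K together with a vertex of C adjacent to all of them (chordality provides one);
-- the diameter bound keeps every dominated vertex dominated, and the component of y shrinks.
-- (i) ⇒ (iii): for a disconnected safe set S and b ∈ K ∖ S, let C₀ be the part of S reachable from
-- K inside S and D₀ the component of ∁ S through b.  The rest P of S hangs off K ∖ S ⊆ D₀, the rest
-- R of ∁ S off K ∩ S ⊆ C₀, and no edge joins P and R (it would close an induced 4-cycle through K).
-- For a component Q of S inside P, either Q outweighs its complement and is a connected safe set,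
-- or C₀ ∪ D₀ ∪ (P ∖ Q) together with just enough of R is a connected safe set no heavier than S.
-- (iii) ⇒ (ii): for x, y at distance at least four, the component of y outside the 3-ball of x, and
-- the component of x outside the 3-ball of that component, have clique boundaries (chordality
-- again).  Heavy weights on an edge leaving each component, and heavier ones on the vertices off
-- both, make the union of the two boundaries a safe set lighter than every connected safe set.
-- Chordality enters through one lemma: two non-adjacent vertices cannot be joined both through a
-- set P and through a set Q disjoint from and non-adjacent to P, since shortcutting the two walks
-- leaves an induced cycle of length at least four.

open import Defs
open import Data.Nat as ℕ using (ℕ; zero; suc; z≤n; s≤s)
import Data.Nat.Properties as ℕ
open import Data.Fin using (Fin; toℕ) renaming (zero to fzero; suc to fsuc)
import Data.Fin.Properties as Fin
open import Data.Fin.Subset as Subset using (Subset; _∈_; _∉_; ∁; ∣_∣)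
open import Data.Fin.Subset.Properties using (p⊂q⇒∣p∣<∣q∣; ∣p∣≤n; anySubset?; _∈?_)
open import Data.Bool as Bool using (Bool; true; false; not; _∧_; _∨_; if_then_else_)
open import Data.Bool.Properties using (not-¬; ¬-not; not-injective)
open import Data.Vec as Vec using (lookup; tabulate)
import Data.Vec.Properties as Vec
open import Data.List as List using (List; []; _∷_; _++_; [_]; length; filter; allFin)
open import Data.List.Properties using (++-assoc; length-++)
open import Data.List.Membership.Propositional using () renaming (_∈_ to _∈ˡ_; _∉_ to _∉ˡ_)
open import Data.List.Membership.Propositional.Properties using (∈-++⁺ˡ; ∈-++⁺ʳ; ∈-++⁻; ∈-∃++; ∈-lookup; ∈-filter⁺; ∈-allFin; ∈-map⁺)
open import Data.List.Relation.Binary.Subset.Propositional using () renaming (_⊆_ to _⊆ˡ_)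
open import Data.List.Relation.Unary.Any as Any using (Any; here; there)
open import Data.List.Relation.Unary.All as All using (All; []; _∷_)
open import Data.List.Relation.Unary.All.Properties using (¬Any⇒All¬; all-filter)
import Data.List.Relation.Unary.All.Properties as All
open import Data.List.Relation.Unary.AllPairs using ([]; _∷_)
open import Data.List.Relation.Unary.Linked using (Linked; []; [-]; _∷_)
open import Data.List.Relation.Unary.Unique.Propositional using (Unique)
open import Data.List.Relation.Unary.Unique.Propositional.Properties using () renaming (++⁺ to Unique-++)
open import Data.List.Extrema.Nat using (argmax; argmax-all; f[xs]≤f[argmax])
open import Data.Rational using (ℚ; 0ℚ; 1ℚ; _+_; _≤_; _<_)
import Data.Rational.Properties as ℚ
open import Data.Rational.Solver using (module +-*-Solver)
open import Algebra.Bundles using (CommutativeMonoid)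
open import Algebra.Properties.CommutativeSemigroup (CommutativeMonoid.commutativeSemigroup ℚ.+-0-commutativeMonoid) using (interchange; xy∙z≈xz∙y; x∙yz≈xz∙y)
open import Data.Product using (Σ; ∃-syntax; _×_; _,_; proj₁; proj₂)
open import Data.Sum as Sum using (_⊎_; inj₁; inj₂)
open import Data.Empty using (⊥; ⊥-elim)
open import Function using (_∘_)
open import Function.Bundles using (_⇔_; mk⇔)
open import Function.Definitions using (Injective)
open import Level using (0ℓ)
open import Effect.Monad using (RawMonad)
open import Relation.Unary using (Pred; Decidable)
open import Relation.Nullary using (¬_; Dec; yes; no; does; _×-dec_; _→-dec_; ¬?)
open import Relation.Nullary.Negation using (¬¬-Monad; DoubleNegation)
open import Relation.Nullary.Decidable using (¬¬-excluded-middle; decidable-stable)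
open import Relation.Binary.PropositionalEquality using (_≡_; _≢_; refl; sym; trans; cong; cong₂; subst; subst₂)

open RawMonad (¬¬-Monad {a = 0ℓ}) using (_>>=_; pure)

¬¬-Π : ∀ {n} {P : Fin n → Set} → (∀ i → DoubleNegation (P i)) → DoubleNegation (∀ i → P i)
¬¬-Π {zero}  f = pure λ ()
¬¬-Π {suc n} f = do
  p₀ ← f fzero
  ps ← ¬¬-Π (f ∘ fsuc)
  pure λ { fzero → p₀ ; (fsuc i) → ps i }

-- Vertex sets are Boolean predicates.  The set cut out by an arbitrary predicate exists only
-- classically, so it is formed in the double-negation monad; every goal that needs one is
-- decidable, and decidable-stable leaves the monad again.
record Comprehension {n} (P : Fin n → Set) : Set where
  field
    set      : Fin n → Bool
    sound    : ∀ {v} → set v ≡ true → P v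
    complete : ∀ {v} → P v → set v ≡ true

¬¬-comprehension : ∀ {n} (P : Fin n → Set) → DoubleNegation (Comprehension P)
¬¬-comprehension P = do
  P? ← ¬¬-Π (λ _ → ¬¬-excluded-middle)
  pure record { set = does ∘ P? ; sound = sound (P? _) ; complete = complete (P? _) }
  where
  sound : ∀ {A} (A? : Dec A) → does A? ≡ true → A
  sound (yes a) _ = a
  complete : ∀ {A} (A? : Dec A) → A → does A? ≡ true
  complete (yes _) _ = refl
  complete (no ¬a) a = ⊥-elim (¬a a)

∨⁻ : ∀ a {b} → (a ∨ b) ≡ true → a ≡ true ⊎ b ≡ true
∨⁻ true  _ = inj₁ refl
∨⁻ false h = inj₂ h

∨⁺ˡ : ∀ {a} b → a ≡ true → (a ∨ b) ≡ true
∨⁺ˡ b refl = refl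

∨⁺ʳ : ∀ a {b} → b ≡ true → (a ∨ b) ≡ true
∨⁺ʳ true  _ = refl
∨⁺ʳ false h = h

∨-false⁻ : ∀ {a b} → (a ∨ b) ≡ false → a ≡ false × b ≡ false
∨-false⁻ {false} h = refl , h

∨-false⁺ : ∀ {a b} → a ≡ false → b ≡ false → (a ∨ b) ≡ false
∨-false⁺ refl refl = refl

∧⁺ : ∀ {a b} → a ≡ true → b ≡ true → (a ∧ b) ≡ true
∧⁺ refl refl = refl

∧⁻ : ∀ {a b} → (a ∧ b) ≡ true → a ≡ true × b ≡ true
∧⁻ {true} h = refl , h

｛_｝ : ∀ {n} → Fin n → Fin n → Bool
｛ v ｝ u = does (u Fin.≟ v)

｛｝-self : ∀ {n} (v : Fin n) → ｛ v ｝ v ≡ true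
｛｝-self v with v Fin.≟ v
... | yes _   = refl
... | no v≢v = ⊥-elim (v≢v refl)

｛｝-sound : ∀ {n} {u v : Fin n} → ｛ v ｝ u ≡ true → u ≡ v
｛｝-sound {u = u} {v} h with u Fin.≟ v
... | yes u≡v = u≡v

module _ {n : ℕ} where

  _⊆ᵇ_ : (Fin n → Bool) → (Fin n → Bool) → Set
  P ⊆ᵇ Q = ∀ {v} → P v ≡ true → Q v ≡ true

  Disjointᵇ : (Fin n → Bool) → (Fin n → Bool) → Set
  Disjointᵇ P Q = ∀ {v} → P v ≡ true → Q v ≡ true → ⊥

sumFin-cong : ∀ {n} {f g : Fin n → ℚ} → (∀ i → f i ≡ g i) → sumFin f ≡ sumFin g
sumFin-cong {zero}  h = refl
sumFin-cong {suc n} h = cong₂ _+_ (h fzero) (sumFin-cong (h ∘ fsuc))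

sumFin-mono : ∀ {n} {f g : Fin n → ℚ} → (∀ i → f i ≤ g i) → sumFin f ≤ sumFin g
sumFin-mono {zero}  h = ℚ.≤-refl
sumFin-mono {suc n} h = ℚ.+-mono-≤ (h fzero) (sumFin-mono (h ∘ fsuc))

sumFin-distrib-+ : ∀ {n} (f g : Fin n → ℚ) → sumFin (λ i → f i + g i) ≡ sumFin f + sumFin g
sumFin-distrib-+ {zero}  f g = refl
sumFin-distrib-+ {suc n} f g =
  trans (cong (f fzero + g fzero +_) (sumFin-distrib-+ (f ∘ fsuc) (g ∘ fsuc)))
        (interchange (f fzero) (g fzero) (sumFin (f ∘ fsuc)) (sumFin (g ∘ fsuc)))

sumFin-zero : ∀ {n} → sumFin {n} (λ _ → 0ℚ) ≡ 0ℚ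
sumFin-zero {zero}  = refl
sumFin-zero {suc n} = trans (ℚ.+-identityˡ _) (sumFin-zero {n})

sumFin-single : ∀ {n} (v : Fin n) (f : Fin n → ℚ) → (∀ i → i ≢ v → f i ≡ 0ℚ) → sumFin f ≡ f v
sumFin-single {suc n} fzero f h =
  trans (cong (f fzero +_) (trans (sumFin-cong (λ i → h (fsuc i) λ ())) (sumFin-zero {n}))) (ℚ.+-identityʳ _)
sumFin-single (fsuc v) f h =
  trans (cong (_+ sumFin (f ∘ fsuc)) (h fzero λ ()))
        (trans (ℚ.+-identityˡ _) (sumFin-single v (f ∘ fsuc) λ i i≢v → h (fsuc i) (i≢v ∘ Fin.suc-injective)))

p≤p+q : ∀ p {q} → 0ℚ ≤ q → p ≤ p + q
p≤p+q p {q} q≥0 = subst (_≤ p + q) (ℚ.+-identityʳ p) (ℚ.+-monoʳ-≤ p q≥0)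

module _ {n : ℕ} where

  NonNegative : (Fin n → ℚ) → Set
  NonNegative w = ∀ v → 0ℚ ≤ w v

  Wt : (Fin n → ℚ) → (Fin n → Bool) → ℚ
  Wt w P = sumFin λ v → if P v then w v else 0ℚ

  Wt-cong : ∀ w {P Q} → (∀ v → P v ≡ Q v) → Wt w P ≡ Wt w Q
  Wt-cong w P≗Q = sumFin-cong λ v → cong (λ b → if b then w v else 0ℚ) (P≗Q v)

  Wt-∅ : ∀ w → Wt w (λ _ → false) ≡ 0ℚ
  Wt-∅ w = sumFin-zero {n}

  Wt-mono : ∀ {w} → NonNegative w → ∀ {P Q} → P ⊆ᵇ Q → Wt w P ≤ Wt w Q
  Wt-mono {w} w≥0 {P} {Q} P⊆Q = sumFin-mono term
    where
    term : ∀ v → (if P v then w v else 0ℚ) ≤ (if Q v then w v else 0ℚ)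
    term v with P v in Pv | Q v in Qv
    ... | true  | true  = ℚ.≤-refl
    ... | true  | false = ⊥-elim (not-¬ (P⊆Q Pv) Qv)
    ... | false | true  = w≥0 v
    ... | false | false = ℚ.≤-refl

  Wt-nonNeg : ∀ {w} → NonNegative w → ∀ P → 0ℚ ≤ Wt w P
  Wt-nonNeg {w} w≥0 P = subst (_≤ Wt w P) (Wt-∅ w) (Wt-mono w≥0 λ ())

  Wt-point : ∀ w (P : Fin n → Bool) v → (∀ u → u ≢ v → P u ≡ false) → Wt w P ≡ (if P v then w v else 0ℚ)
  Wt-point w P v off = sumFin-single v _ λ u u≢v → cong (λ b → if b then w u else 0ℚ) (off u u≢v)

  ≤-Wt : ∀ {w} → NonNegative w → ∀ {P v} → P v ≡ true → w v ≤ Wt w P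
  ≤-Wt {w} w≥0 {P} {v} Pv =
    subst (_≤ Wt w P) singleton (Wt-mono w≥0 {｛ v ｝} λ h → subst (λ u → P u ≡ true) (sym (｛｝-sound h)) Pv)
    where
    singleton : Wt w ｛ v ｝ ≡ w v
    singleton = trans (Wt-point w ｛ v ｝ v λ u u≢v → ¬-not (u≢v ∘ ｛｝-sound))
                      (cong (λ b → if b then w v else 0ℚ) (｛｝-self v))

  Wt-∨ : ∀ w {P Q} → Disjointᵇ P Q → Wt w (λ v → P v ∨ Q v) ≡ Wt w P + Wt w Q
  Wt-∨ w {P} {Q} P∩Q=∅ = trans (sumFin-cong term) (sumFin-distrib-+ {n} _ _)
    where
    term : ∀ v → (if P v ∨ Q v then w v else 0ℚ) ≡ (if P v then w v else 0ℚ) + (if Q v then w v else 0ℚ)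
    term v with P v in Pv | Q v in Qv
    ... | true  | true  = ⊥-elim (P∩Q=∅ Pv Qv)
    ... | true  | false = sym (ℚ.+-identityʳ _)
    ... | false | _     = sym (ℚ.+-identityˡ _)

  Wt-+ : ∀ w₁ w₂ P → Wt (λ v → w₁ v + w₂ v) P ≡ Wt w₁ P + Wt w₂ P
  Wt-+ w₁ w₂ P = trans (sumFin-cong term) (sumFin-distrib-+ {n} _ _)
    where
    term : ∀ v → (if P v then w₁ v + w₂ v else 0ℚ) ≡ (if P v then w₁ v else 0ℚ) + (if P v then w₂ v else 0ℚ)
    term v with P v
    ... | true  = refl
    ... | false = sym (ℚ.+-identityˡ _)

  Wt-point-mass : ∀ (a : Fin n) c (P : Fin n → Bool) → Wt (λ v → if ｛ a ｝ v then c else 0ℚ) P ≡ (if P a then c else 0ℚ)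
  Wt-point-mass a c P = trans (sumFin-single a _ off) (at-a (P a))
    where
    off : ∀ v → v ≢ a → (if P v then (if ｛ a ｝ v then c else 0ℚ) else 0ℚ) ≡ 0ℚ
    off v v≢a with P v | ｛ a ｝ v in h
    ... | false | _     = refl
    ... | true  | false = refl
    ... | true  | true  = ⊥-elim (v≢a (｛｝-sound h))
    at-a : ∀ b → (if b then (if ｛ a ｝ a then c else 0ℚ) else 0ℚ) ≡ (if b then c else 0ℚ)
    at-a false = refl
    at-a true  = cong (λ b → if b then c else 0ℚ) (｛｝-self a)

-- X grows vertex by vertex while base + Wt w X < q; each step adds at most c ≤ base − d, so d + Wt w X ≤ q
greedy-subset : ∀ {n} {w : Fin n → ℚ} (R : Fin n → Bool) {c} → (∀ {r} → R r ≡ true → w r ≤ c) →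
  ∀ {base d q} → d ≤ q → d + c ≤ base → q ≤ base + Wt w R →
  Σ (Fin n → Bool) λ X → X ⊆ᵇ R × q ≤ base + Wt w X × d + Wt w X ≤ q
greedy-subset {zero} R w≤c {d = d} {q} d≤q _ q≤ = (λ ()) , (λ {}) , q≤ , subst (_≤ q) (sym (ℚ.+-identityʳ d)) d≤q
greedy-subset {suc n} {w} R {c} w≤c {base} {d} {q} d≤q d+c≤base q≤ with q ℚ.≤? base
... | yes q≤base = (λ _ → false) , (λ ()) ,
                   subst (q ≤_) (sym (trans (cong (base +_) (Wt-∅ w)) (ℚ.+-identityʳ base))) q≤base ,
                   subst (_≤ q) (sym (trans (cong (d +_) (Wt-∅ w)) (ℚ.+-identityʳ d))) d≤q
... | no q≰base with R fzero in R₀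
...   | true with greedy-subset (R ∘ fsuc) w≤c {base + w fzero} {d + w fzero} {q}
                  (ℚ.<⇒≤ (ℚ.≤-<-trans (ℚ.≤-trans (ℚ.+-monoʳ-≤ d (w≤c R₀)) d+c≤base) (ℚ.≰⇒> q≰base)))
                  (subst (_≤ base + w fzero) (xy∙z≈xz∙y d c (w fzero)) (ℚ.+-monoˡ-≤ (w fzero) d+c≤base))
                  (subst (q ≤_) (sym (ℚ.+-assoc base (w fzero) _)) q≤)
...     | X , X⊆R , q≤′ , ≤q′ = (λ { fzero → true ; (fsuc i) → X i }) , (λ { {fzero} _ → R₀ ; {fsuc i} h → X⊆R h }) ,
                                subst (q ≤_) (ℚ.+-assoc base (w fzero) _) q≤′ ,
                                subst (_≤ q) (ℚ.+-assoc d (w fzero) _) ≤q′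
greedy-subset {suc n} {w} R {c} w≤c {base} {d} {q} d≤q d+c≤base q≤ | no q≰base | false
  with greedy-subset (R ∘ fsuc) w≤c d≤q d+c≤base (subst (λ x → q ≤ base + x) (ℚ.+-identityˡ _) q≤)
... | X , X⊆R , q≤′ , ≤q′ = (λ { fzero → false ; (fsuc i) → X i }) , (λ { {fzero} () ; {fsuc i} h → X⊆R h }) ,
                            subst (λ x → q ≤ base + x) (sym (ℚ.+-identityˡ _)) q≤′ ,
                            subst (λ x → d + x ≤ q) (sym (ℚ.+-identityˡ _)) ≤q′

∈⇒lookup : ∀ {n x} {S : Subset n} → x ∈ S → lookup S x ≡ true
∈⇒lookup = Vec.[]=⇒lookup

lookup⇒∈ : ∀ {n x} {S : Subset n} → lookup S x ≡ true → x ∈ S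
lookup⇒∈ = Vec.lookup⇒[]= _ _

lookup-∁ : ∀ {n} (S : Subset n) x → lookup (∁ S) x ≡ not (lookup S x)
lookup-∁ S x = Vec.lookup-map x not S

∁-true : ∀ {n} (S : Subset n) {x} → lookup S x ≡ false → lookup (∁ S) x ≡ true
∁-true S {x} ¬Sx = trans (lookup-∁ S x) (cong not ¬Sx)

∁-false : ∀ {n} (S : Subset n) {x} → lookup (∁ S) x ≡ true → lookup S x ≡ false
∁-false S {x} h = not-injective (trans (sym (lookup-∁ S x)) h)

∈-tabulate⁻ : ∀ {n x} {P : Fin n → Bool} → x ∈ tabulate P → P x ≡ true
∈-tabulate⁻ {x = x} {P} x∈ = trans (sym (Vec.lookup∘tabulate P x)) (∈⇒lookup x∈)

∈-tabulate⁺ : ∀ {n x} {P : Fin n → Bool} → P x ≡ true → x ∈ tabulate P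
∈-tabulate⁺ {x = x} {P} Px = lookup⇒∈ (trans (Vec.lookup∘tabulate P x) Px)

Wt-tabulate : ∀ {n} w (P : Fin n → Bool) → wt w (tabulate P) ≡ Wt w P
Wt-tabulate w P = Wt-cong w (Vec.lookup∘tabulate P)

module Graphs {n : ℕ} (G : Graph n) where

  E-sym : ∀ {x y} → E G x y → E G y x
  E-sym {x} {y} = trans (Graph.sym G y x)

  E-irrefl : ∀ {x} → ¬ E G x x
  E-irrefl {x} e = not-¬ e (Graph.irrefl G x)

  E? : ∀ x y → Dec (E G x y)
  E? x y = Graph.adj G x y Bool.≟ true

  NeighbourIn : (Fin n → Bool) → Fin n → Set
  NeighbourIn P u = Σ (Fin n) λ a → P a ≡ true × E G u a

  Cliqueᵇ : (Fin n → Bool) → Set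
  Cliqueᵇ K = ∀ {a b} → K a ≡ true → K b ≡ true → a ≢ b → E G a b

  Dominates : (Fin n → Bool) → Fin n → Set
  Dominates K v = K v ≡ true ⊎ NeighbourIn K v

  attached : (Fin n → Bool) → Fin n → Bool
  attached C σ = does (Fin.any? λ c → (C c Bool.≟ true) ×-dec E? σ c)

  attached⁺ : ∀ {C σ c} → C c ≡ true → E G σ c → attached C σ ≡ true
  attached⁺ {C} {σ} Cc σc with Fin.any? (λ c → (C c Bool.≟ true) ×-dec E? σ c)
  ... | yes _ = refl
  ... | no ∄c = ⊥-elim (∄c (_ , Cc , σc))

  attached⁻ : ∀ {C σ} → attached C σ ≡ true → NeighbourIn C σ
  attached⁻ {C} {σ} h with Fin.any? (λ c → (C c Bool.≟ true) ×-dec E? σ c)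
  ... | yes ∃c = ∃c
  ... | no _   = ⊥-elim (not-¬ h refl)

  data Path (P : Fin n → Bool) : Fin n → Fin n → Set where
    here : ∀ {x} → P x ≡ true → Path P x x
    step : ∀ {x y z} → P x ≡ true → E G x y → Path P y z → Path P x z

  module _ {P : Fin n → Bool} where

    path-start : ∀ {x y} → Path P x y → P x ≡ true
    path-start (here Px)     = Px
    path-start (step Px _ _) = Px

    path-end : ∀ {x y} → Path P x y → P y ≡ true
    path-end (here Py)    = Py
    path-end (step _ _ p) = path-end p

    infixr 5 _++ᵖ_
    _++ᵖ_ : ∀ {x y z} → Path P x y → Path P y z → Path P x z
    here _     ++ᵖ q = q
    step Px e p ++ᵖ q = step Px e (p ++ᵖ q)

    path-snoc : ∀ {x y z} → Path P x y → E G y z → P z ≡ true → Path P x z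
    path-snoc p e Pz = p ++ᵖ step (path-end p) e (here Pz)

    path-reverse : ∀ {x y} → Path P x y → Path P y x
    path-reverse (here Px)     = here Px
    path-reverse (step Px e p) = path-snoc (path-reverse p) (E-sym e) Px

  path-map : ∀ {P Q} → P ⊆ᵇ Q → ∀ {x y} → Path P x y → Path Q x y
  path-map P⊆Q (here Px)     = here (P⊆Q Px)
  path-map P⊆Q (step Px e p) = step (P⊆Q Px) e (path-map P⊆Q p)

  ClosedUnder : (Fin n → Bool) → (Fin n → Bool) → Set
  ClosedUnder Q P = ∀ {u v} → Q u ≡ true → P v ≡ true → E G u v → Q v ≡ true

  path-lift : ∀ {P Q} → ClosedUnder Q P → ∀ {x y} → Q x ≡ true → Path P x y → Path Q x y
  path-lift Q-closed Qx (here _)     = here Qx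
  path-lift Q-closed Qx (step _ e p) = step Qx e (path-lift Q-closed (Q-closed Qx (path-start p) e) p)

  path-closed : ∀ {P Q} → ClosedUnder Q P → ∀ {x y} → Q x ≡ true → Path P x y → Q y ≡ true
  path-closed Q-closed Qx p = path-end (path-lift Q-closed Qx p)

  Connectedᵇ : (Fin n → Bool) → Set
  Connectedᵇ P = ∀ {a b} → P a ≡ true → P b ≡ true → Path P a b

  rooted⇒connected : ∀ {P r} → (∀ {b} → P b ≡ true → Path P r b) → Connectedᵇ P
  rooted⇒connected root Pa Pb = path-reverse (root Pa) ++ᵖ root Pb

  module _ {P y} (R : Comprehension (Path P y)) where
    private module R = Comprehension R

    reach⊆ : R.set ⊆ᵇ P
    reach⊆ Rv = path-end (R.sound Rv)

    reach-closed : ClosedUnder R.set P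
    reach-closed Ru Pv e = R.complete (path-snoc (R.sound Ru) e Pv)

    reach-connected : Connectedᵇ R.set
    reach-connected = rooted⇒connected λ Rb → path-lift reach-closed (R.complete (here (path-start (R.sound Rb)))) (R.sound Rb)

  path-exit : ∀ {P} (Q : Fin n → Bool) {x y} → Path P x y → Q x ≡ false → Q y ≡ true →
    Σ _ λ d → Σ _ λ c → Path (λ v → P v ∧ not (Q v)) x d × E G d c × P c ≡ true × Q c ≡ true
  path-exit Q (here _) Qx Qy = ⊥-elim (not-¬ Qy Qx)
  path-exit Q {x} (step {y = z} Px e p) Qx Qy with Q z in Qz
  ... | true  = x , z , here (∧⁺ Px (cong not Qx)) , e , path-start p , Qz
  ... | false with path-exit Q p Qz Qy
  ...   | d , c , q , e′ , Pc , Qc = d , c , step (∧⁺ Px (cong not Qx)) e q , e′ , Pc , Qc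

  toPathIn : ∀ {S x y} → Path (lookup S) x y → PathIn G S x y
  toPathIn (here Sx)     = here (lookup⇒∈ Sx)
  toPathIn (step Sx e p) = step (lookup⇒∈ Sx) e (toPathIn p)

  fromPathIn : ∀ {S x y} → PathIn G S x y → Path (lookup S) x y
  fromPathIn (here x∈S)     = here (∈⇒lookup x∈S)
  fromPathIn (step x∈S e p) = step (∈⇒lookup x∈S) e (fromPathIn p)

  walk-snoc : ∀ {l x y z} → Walk G l x y → E G y z → Walk G (suc l) x z
  walk-snoc nil        e = cons e nil
  walk-snoc (cons e′ w) e = cons e′ (walk-snoc w e)

  walk-reverse : ∀ {l x y} → Walk G l x y → Walk G l y x
  walk-reverse nil        = nil
  walk-reverse (cons e w) = walk-snoc (walk-reverse w) (E-sym e)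

  walk-unsnoc : ∀ {l x z} → Walk G (suc l) x z → Σ _ λ y → Walk G l x y × E G y z
  walk-unsnoc (cons e nil)        = _ , nil , e
  walk-unsnoc (cons e (cons e′ w)) with walk-unsnoc (cons e′ w)
  ... | y , w′ , e″ = y , cons e w′ , e″

  walk⇒path : ∀ {l x y} → Walk G l x y → Path (λ _ → true) x y
  walk⇒path nil        = here refl
  walk⇒path (cons e w) = step refl e (walk⇒path w)

  walk-exit : ∀ (P : Fin n → Bool) {l x z} → P x ≡ true → P z ≡ false → Walk G l x z →
    Σ _ λ a → Σ _ λ b → P a ≡ true × P b ≡ false × E G a b
  walk-exit P Px Pz nil = ⊥-elim (not-¬ Px Pz)
  walk-exit P {x = x} Px Pz (cons {y = y} e w) with P y in Py
  ... | true  = walk-exit P Py Pz w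
  ... | false = x , y , Px , Py , e

  module _ {S C : Subset n} (C-comp : IsComponent G S C) where

    component⊆ : ∀ {x} → x ∈ C → lookup S x ≡ true
    component⊆ x∈C = ∈⇒lookup (proj₁ (proj₂ C-comp) _ x∈C)

    component-path : ∀ {x z} → x ∈ C → z ∈ C → Path (lookup S) x z
    component-path x∈C z∈C =
      path-map (λ {v} v∈C → component⊆ (lookup⇒∈ v∈C)) (fromPathIn (proj₁ (proj₂ (proj₂ C-comp)) _ _ x∈C z∈C))

    component-connected : Connectedᵇ (lookup C)
    component-connected {a} {b} Ca Cb = fromPathIn (proj₁ (proj₂ (proj₂ C-comp)) a b (lookup⇒∈ Ca) (lookup⇒∈ Cb))

    component-reach : ∀ {x z} → x ∈ C → Path (lookup S) x z → z ∈ C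
    component-reach x∈C p =
      lookup⇒∈ (path-closed (λ u∈C Sv e → ∈⇒lookup (proj₂ (proj₂ (proj₂ C-comp)) _ _ (lookup⇒∈ u∈C) (lookup⇒∈ Sv) e))
                            (∈⇒lookup x∈C) p)

    component-within : ∀ {U} → ClosedUnder U (lookup S) → ∀ {x} → x ∈ C → U x ≡ true → ∀ {z} → z ∈ C → U z ≡ true
    component-within U-closed x∈C Ux z∈C = path-closed U-closed Ux (component-path x∈C z∈C)

  ¬¬-component : ∀ S {y} → lookup S y ≡ true → DoubleNegation (Σ (Subset n) λ C → IsComponent G S C × y ∈ C)
  ¬¬-component S {y} Sy = do
    R ← ¬¬-comprehension (Path (lookup S) y)
    let open Comprehension R
        y∈C = ∈-tabulate⁺ (complete (here Sy))
    pure (tabulate set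
         , ( (y , y∈C)
           , (λ x x∈C → lookup⇒∈ (reach⊆ R (∈-tabulate⁻ x∈C)))
           , (λ a b a∈C b∈C → toPathIn (path-map (λ {v} → trans (Vec.lookup∘tabulate set v))
                                                  (reach-connected R (∈-tabulate⁻ a∈C) (∈-tabulate⁻ b∈C))))
           , (λ a b a∈C Sb e → ∈-tabulate⁺ (reach-closed R (∈-tabulate⁻ a∈C) (∈⇒lookup Sb) e)) )
         , y∈C)

  module _ {w : Fin n → ℚ} (w≥0 : NonNegative w) where

    connected-safe : ∀ T {t₀} → T t₀ ≡ true → Connectedᵇ T →
      (∀ D → IsComponent G (∁ (tabulate T)) D → wt w D ≤ Wt w T) → IsConnSafe G w (tabulate T)
    connected-safe T Tt₀ T-conn light = ((_ , ∈-tabulate⁺ Tt₀) , safe) , connected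
      where
      T⊆ : T ⊆ᵇ lookup (tabulate T)
      T⊆ {v} = trans (Vec.lookup∘tabulate T v)
      connected : ∀ x y → x ∈ tabulate T → y ∈ tabulate T → PathIn G (tabulate T) x y
      connected x y x∈T y∈T = toPathIn (path-map T⊆ (T-conn (∈-tabulate⁻ x∈T) (∈-tabulate⁻ y∈T)))
      safe : ∀ C D → IsComponent G (tabulate T) C → IsComponent G (∁ (tabulate T)) D →
        (∃[ x ] ∃[ y ] (x ∈ C × y ∈ D × E G x y)) → wt w D ≤ wt w C
      safe C D C-comp D-comp _ = ℚ.≤-trans (light D D-comp) (Wt-mono w≥0 T⊆C)
        where
        c = proj₁ (proj₁ C-comp)
        c∈C = proj₂ (proj₁ C-comp)
        T⊆C : T ⊆ᵇ lookup C
        T⊆C Tv = ∈⇒lookup (component-reach C-comp c∈C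
                   (path-map T⊆ (T-conn (∈-tabulate⁻ (proj₁ (proj₂ C-comp) c c∈C)) Tv)))

    safe⇒light-component : Connected G → ∀ {T} → IsSafe G w T → ∀ {d} → lookup T d ≡ false →
      DoubleNegation (Σ (Subset n) λ D → IsComponent G (∁ T) D × d ∈ D × wt w D ≤ wt w T)
    safe⇒light-component conn {T} ((t₀ , t₀∈T) , safe) {d} Td = do
      (D , D-comp , d∈D) ← ¬¬-component (∁ T) (∁-true T Td)
      let (a , b , Da , Db , e) = walk-exit (lookup D) (∈⇒lookup d∈D) (D∌t₀ D-comp) (proj₂ (conn d t₀))
      (C , C-comp , b∈C) ← ¬¬-component T (exits-into-T D-comp Da Db e)
      pure (D , D-comp , d∈D , ℚ.≤-trans (safe C D C-comp D-comp (b , a , b∈C , lookup⇒∈ Da , E-sym e))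
                                          (Wt-mono w≥0 λ b∈C′ → ∈⇒lookup (proj₁ (proj₂ C-comp) _ (lookup⇒∈ b∈C′))))
      where
      exits-into-T : ∀ {D a b} → IsComponent G (∁ T) D → lookup D a ≡ true → lookup D b ≡ false → E G a b →
        lookup T b ≡ true
      exits-into-T D-comp Da Db e = ¬-not λ Tb → not-¬ (∈⇒lookup (component-reach D-comp (lookup⇒∈ Da)
        (step (component⊆ D-comp (lookup⇒∈ Da)) e (here (∁-true T Tb))))) Db
      D∌t₀ : ∀ {D} → IsComponent G (∁ T) D → lookup D t₀ ≡ false
      D∌t₀ D-comp = ¬-not λ Dt₀ → not-¬ (∈⇒lookup t₀∈T) (∁-false T (component⊆ D-comp (lookup⇒∈ Dt₀)))

split-last : ∀ {A : Set} {P : Pred A 0ℓ} → Decidable P → ∀ xs → Any P xs →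
  Σ (List A) λ ys → Σ A λ v → Σ (List A) λ zs → xs ≡ ys ++ v ∷ zs × P v × All (¬_ ∘ P) zs
split-last P? (x ∷ xs) Pxs with Any.any? P? xs
... | yes Pxs′ with split-last P? xs Pxs′
...   | ys , v , zs , refl , Pv , ¬Pzs = x ∷ ys , v , zs , refl , Pv , ¬Pzs
split-last P? (x ∷ xs) (here Px)    | no ¬Pxs = [] , x , xs , refl , Px , ¬Any⇒All¬ xs ¬Pxs
split-last P? (x ∷ xs) (there Pxs′) | no ¬Pxs = ⊥-elim (¬Pxs Pxs′)

unique-++⁻ˡ : ∀ {A : Set} (xs : List A) {ys} → Unique (xs ++ ys) → Unique xs
unique-++⁻ˡ []       _          = []
unique-++⁻ˡ (x ∷ xs) (x∉ ∷ xs!) = All.++⁻ˡ xs x∉ ∷ unique-++⁻ˡ xs xs!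

lookup-injective : ∀ {A : Set} {xs : List A} → Unique xs → ∀ {i j} → List.lookup xs i ≡ List.lookup xs j → i ≡ j
lookup-injective (_ ∷ _)  {fzero}  {fzero}  _  = refl
lookup-injective (x∉ ∷ _) {fzero}  {fsuc j} eq = ⊥-elim (All.lookup x∉ (∈-lookup j) eq)
lookup-injective (x∉ ∷ _) {fsuc i} {fzero}  eq = ⊥-elim (All.lookup x∉ (∈-lookup i) (sym eq))
lookup-injective (_ ∷ xs!) {fsuc i} {fsuc j} eq = cong fsuc (lookup-injective xs! eq)

length-++-∷≥3 : ∀ {A : Set} (xs : List A) {v} ys → xs ≢ [] → ys ≢ [] → 3 ℕ.≤ length (xs ++ v ∷ ys)
length-++-∷≥3 []       _        xs≢[] _     = ⊥-elim (xs≢[] refl)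
length-++-∷≥3 (_ ∷ _)  []       _     ys≢[] = ⊥-elim (ys≢[] refl)
length-++-∷≥3 (_ ∷ xs) (_ ∷ ys) _     _     =
  s≤s (subst (2 ℕ.≤_) (sym (length-++ xs)) (ℕ.≤-trans (s≤s (s≤s z≤n)) (ℕ.m≤n+m _ (length xs))))

module InducedPaths {n : ℕ} (G : Graph n) where
  open Graphs G

  data Consecutive (x y : Fin n) : List (Fin n) → Set where
    here  : ∀ {zs} → Consecutive x y (x ∷ y ∷ zs)
    there : ∀ {z zs} → Consecutive x y zs → Consecutive x y (z ∷ zs)

  consecutive-++ʳ : ∀ xs {ys x y} → Consecutive x y ys → Consecutive x y (xs ++ ys)
  consecutive-++ʳ []       c = c
  consecutive-++ʳ (_ ∷ xs) c = there (consecutive-++ʳ xs c)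

  consecutive-glue : ∀ xs {v ys x y} → Consecutive x y (xs ++ [ v ]) → Consecutive x y (xs ++ v ∷ ys)
  consecutive-glue (_ ∷ [])     here      = here
  consecutive-glue (_ ∷ _ ∷ _)  here      = here
  consecutive-glue (_ ∷ x ∷ xs) (there c) = there (consecutive-glue (x ∷ xs) c)
  consecutive-glue (_ ∷ [])     (there (there ()))
  consecutive-glue []           (there ())

  consecutive-split : ∀ xs {v ys x y} → Consecutive x y (xs ++ v ∷ ys) →
    Consecutive x y (xs ++ [ v ]) ⊎ Consecutive x y (v ∷ ys)
  consecutive-split []           c         = inj₂ c
  consecutive-split (_ ∷ [])     here      = inj₁ here
  consecutive-split (_ ∷ [])     (there c) = inj₂ c
  consecutive-split (_ ∷ _ ∷ _)  here      = inj₁ here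
  consecutive-split (_ ∷ x ∷ xs) (there c) = Sum.map₁ there (consecutive-split (x ∷ xs) c)

  -- consecutive pairs of xs ++ [ h ] by position; with h the head of xs they are the edges of a cycle
  snoc-consecutive⁺ : ∀ xs {h} {i j : Fin (length xs)} → toℕ j ≡ suc (toℕ i) →
    Consecutive (List.lookup xs i) (List.lookup xs j) (xs ++ [ h ])
  snoc-consecutive⁺ (_ ∷ _ ∷ _)  {i = fzero}  {fsuc fzero}    refl = here
  snoc-consecutive⁺ (_ ∷ xs)     {i = fsuc i} {fsuc j}        eq   = there (snoc-consecutive⁺ xs (ℕ.suc-injective eq))
  snoc-consecutive⁺ (_ ∷ _ ∷ _)  {i = fzero}  {fsuc (fsuc j)} ()
  snoc-consecutive⁺ (_ ∷ _)      {i = fzero}  {fzero}         ()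
  snoc-consecutive⁺ (_ ∷ _)      {i = fsuc i} {fzero}         ()

  snoc-consecutive-last : ∀ xs {h} {i : Fin (length xs)} → suc (toℕ i) ≡ length xs →
    Consecutive (List.lookup xs i) h (xs ++ [ h ])
  snoc-consecutive-last (_ ∷ [])     {i = fzero}  refl = here
  snoc-consecutive-last (_ ∷ x ∷ xs) {i = fsuc i} eq   = there (snoc-consecutive-last (x ∷ xs) (ℕ.suc-injective eq))
  snoc-consecutive-last (_ ∷ _ ∷ _)  {i = fzero}  ()

  snoc-consecutive⁻ : ∀ xs {h x y} → Consecutive x y (xs ++ [ h ]) →
    Σ (Fin (length xs)) λ i → List.lookup xs i ≡ x ×
      ((Σ (Fin (length xs)) λ j → toℕ j ≡ suc (toℕ i) × List.lookup xs j ≡ y) ⊎ (suc (toℕ i) ≡ length xs × y ≡ h))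
  snoc-consecutive⁻ (_ ∷ [])     here      = fzero , refl , inj₂ (refl , refl)
  snoc-consecutive⁻ (_ ∷ _ ∷ _)  here      = fzero , refl , inj₁ (fsuc fzero , refl , refl)
  snoc-consecutive⁻ (_ ∷ x ∷ xs) (there c) with snoc-consecutive⁻ (x ∷ xs) c
  ... | i , xᵢ , inj₁ (j , j≡1+i , yⱼ) = fsuc i , xᵢ , inj₁ (fsuc j , cong suc j≡1+i , yⱼ)
  ... | i , xᵢ , inj₂ (i-last , y≡h)  = fsuc i , xᵢ , inj₂ (cong suc i-last , y≡h)
  snoc-consecutive⁻ (_ ∷ [])     (there (there ()))
  snoc-consecutive⁻ []           (there ())

  data InducedPath : List (Fin n) → Set where
    single : ∀ {x} → InducedPath [ x ]
    extend : ∀ {x y ys} → x ∉ˡ y ∷ ys → E G x y → All (¬_ ∘ E G x) ys → InducedPath (y ∷ ys) → InducedPath (x ∷ y ∷ ys)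

  induced-suffix : ∀ xs {y ys} → InducedPath (xs ++ y ∷ ys) → InducedPath (y ∷ ys)
  induced-suffix []           π                = π
  induced-suffix (_ ∷ [])     (extend _ _ _ π) = π
  induced-suffix (_ ∷ x ∷ xs) (extend _ _ _ π) = induced-suffix (x ∷ xs) π

  induced-consecutive : ∀ {π x y} → InducedPath π → Consecutive x y π → E G x y
  induced-consecutive (extend _ e _ _) here      = e
  induced-consecutive (extend _ _ _ π) (there c) = induced-consecutive π c

  induced-chordless : ∀ {π x y} → InducedPath π → x ∈ˡ π → y ∈ˡ π → E G x y → Consecutive x y π ⊎ Consecutive y x π
  induced-chordless single (here refl) (here refl) e = ⊥-elim (E-irrefl e)
  induced-chordless (extend _ _ _ _) (here refl) (here refl) e = ⊥-elim (E-irrefl e)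
  induced-chordless (extend _ _ _ _) (here refl) (there (here refl)) e = inj₁ here
  induced-chordless (extend _ _ ¬e _) (here refl) (there (there y∈)) e = ⊥-elim (All.lookup ¬e y∈ e)
  induced-chordless (extend _ _ _ _) (there (here refl)) (here refl) e = inj₂ here
  induced-chordless (extend _ _ ¬e _) (there (there x∈)) (here refl) e = ⊥-elim (All.lookup ¬e x∈ (E-sym e))
  induced-chordless (extend _ _ _ π) (there x∈) (there y∈) e = Sum.map there there (induced-chordless π x∈ y∈ e)

  induced-head∉ : ∀ {x xs} → InducedPath (x ∷ xs) → x ∉ˡ xs
  induced-head∉ single           ()
  induced-head∉ (extend x∉ _ _ _) = x∉

  induced-last∉ : ∀ {x} xs {z} → InducedPath (x ∷ xs ++ [ z ]) → z ∉ˡ xs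
  induced-last∉ (y ∷ ys) (extend _ _ _ π) (here refl) = induced-head∉ π (∈-++⁺ʳ ys (here refl))
  induced-last∉ (y ∷ ys) (extend _ _ _ π) (there z∈) = induced-last∉ ys π z∈

  induced-unique : ∀ {π} → InducedPath π → Unique π
  induced-unique single                    = [] ∷ []
  induced-unique (extend {ys = ys} x∉ _ _ π) = ¬Any⇒All¬ (_ ∷ ys) x∉ ∷ induced-unique π

  private
    snoc-split : ∀ {xs ys zs : List (Fin n)} {v z} → xs ≡ ys ++ v ∷ zs →
      InducedPath (xs ++ [ z ]) → InducedPath (ys ++ v ∷ zs ++ [ z ])
    snoc-split {ys = ys} {zs} {v} {z} eq = subst InducedPath (trans (cong (_++ [ z ]) eq) (++-assoc ys (v ∷ zs) [ z ]))

    suffix⊆ : ∀ {w : Fin n} {q ws} xs {v ys} → w ∷ q ≡ xs ++ v ∷ ys → q ⊆ˡ ws → v ∷ ys ⊆ˡ w ∷ ws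
    suffix⊆ xs eq q⊆ws {x} x∈ with subst (x ∈ˡ_) (sym eq) (∈-++⁺ʳ xs x∈)
    ... | here refl = here refl
    ... | there v∈q = there (q⊆ws v∈q)

  -- shortcut the walk at the last neighbour of its first vertex
  induced-subpath : ∀ {u z} ws → Linked (E G) (u ∷ ws ++ [ z ]) → u ≢ z →
    Σ (List (Fin n)) λ p → InducedPath (u ∷ p ++ [ z ]) × p ⊆ˡ ws
  induced-subpath {u} {z} ws walk u≢z with E? u z
  ... | yes e = [] , extend (λ { (here u≡z) → u≢z u≡z }) e [] single , λ ()
  induced-subpath []       (e ∷ _)    u≢z | no ¬e = ⊥-elim (¬e e)
  induced-subpath {u} {z} (w ∷ ws) (e ∷ walk) u≢z | no ¬e
    with induced-subpath ws walk (λ { refl → ¬e e })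
  ... | q , π , q⊆ws with Any.any? (u Fin.≟_) (w ∷ q)
  ...   | yes u∈ with ∈-∃++ u∈
  ...     | xs , ys , eq = ys , induced-suffix xs (snoc-split eq π) , λ x∈ → suffix⊆ xs eq q⊆ws (there x∈)
  induced-subpath {u} {z} (w ∷ ws) (e ∷ walk) u≢z | no ¬e | q , π , q⊆ws | no u∉
    with split-last (E? u) (w ∷ q) (here e)
  ... | xs , v , ys , eq , euv , ¬Eys =
    v ∷ ys , extend u∉path euv (All.++⁺ ¬Eys (¬e ∷ [])) (induced-suffix xs (snoc-split eq π)) , suffix⊆ xs eq q⊆ws
    where
    u∉path : u ∉ˡ v ∷ ys ++ [ z ]
    u∉path u∈ with ∈-++⁻ (v ∷ ys) u∈
    ... | inj₁ u∈vys      = u∉ (subst (u ∈ˡ_) (sym eq) (∈-++⁺ʳ xs u∈vys))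
    ... | inj₂ (here u≡z) = u≢z u≡z

  module Glued {u u′ p q} (π₁ : InducedPath (u ∷ p ++ [ u′ ])) (π₂ : InducedPath (u′ ∷ q ++ [ u ]))
    (p∩q=∅ : ∀ {x} → x ∈ˡ p → x ∉ˡ q) (p≁q : ∀ {x y} → x ∈ˡ p → y ∈ˡ q → ¬ E G x y) where

    private
      cycle≡ : u ∷ (p ++ u′ ∷ q) ++ [ u ] ≡ (u ∷ p) ++ u′ ∷ (q ++ [ u ])
      cycle≡ = cong (u ∷_) (++-assoc p (u′ ∷ q) [ u ])

      on₁ : ∀ {x} → x ∈ˡ p → x ∈ˡ u ∷ p ++ [ u′ ]
      on₁ = there ∘ ∈-++⁺ˡ

      on₂ : ∀ {x} → x ∈ˡ q → x ∈ˡ u′ ∷ q ++ [ u ]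
      on₂ = there ∘ ∈-++⁺ˡ

      side : ∀ {x} → x ∈ˡ u ∷ p ++ u′ ∷ q → x ∈ˡ p ⊎ x ∈ˡ q ⊎ (x ∈ˡ u ∷ p ++ [ u′ ] × x ∈ˡ u′ ∷ q ++ [ u ])
      side (here refl) = inj₂ (inj₂ (here refl , there (∈-++⁺ʳ q (here refl))))
      side (there x∈) with ∈-++⁻ p x∈
      ... | inj₁ x∈p         = inj₁ x∈p
      ... | inj₂ (here refl) = inj₂ (inj₂ (there (∈-++⁺ʳ p (here refl)) , here refl))
      ... | inj₂ (there x∈q) = inj₂ (inj₁ x∈q)

      same-side : ∀ {x y} → x ∈ˡ u ∷ p ++ u′ ∷ q → y ∈ˡ u ∷ p ++ u′ ∷ q → E G x y →
        (x ∈ˡ u ∷ p ++ [ u′ ] × y ∈ˡ u ∷ p ++ [ u′ ]) ⊎ (x ∈ˡ u′ ∷ q ++ [ u ] × y ∈ˡ u′ ∷ q ++ [ u ])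
      same-side x∈ y∈ e with side x∈ | side y∈
      ... | inj₁ x∈p              | inj₁ y∈p              = inj₁ (on₁ x∈p , on₁ y∈p)
      ... | inj₁ x∈p              | inj₂ (inj₁ y∈q)       = ⊥-elim (p≁q x∈p y∈q e)
      ... | inj₁ x∈p              | inj₂ (inj₂ (y₁ , _))  = inj₁ (on₁ x∈p , y₁)
      ... | inj₂ (inj₁ x∈q)       | inj₁ y∈p              = ⊥-elim (p≁q y∈p x∈q (E-sym e))
      ... | inj₂ (inj₁ x∈q)       | inj₂ (inj₁ y∈q)       = inj₂ (on₂ x∈q , on₂ y∈q)
      ... | inj₂ (inj₁ x∈q)       | inj₂ (inj₂ (_ , y₂))  = inj₂ (on₂ x∈q , y₂)
      ... | inj₂ (inj₂ (x₁ , _))  | inj₁ y∈p              = inj₁ (x₁ , on₁ y∈p)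
      ... | inj₂ (inj₂ (_ , x₂))  | inj₂ (inj₁ y∈q)       = inj₂ (x₂ , on₂ y∈q)
      ... | inj₂ (inj₂ (x₁ , _))  | inj₂ (inj₂ (y₁ , _))  = inj₁ (x₁ , y₁)

    glued-chain : ∀ {x y} → Consecutive x y (u ∷ (p ++ u′ ∷ q) ++ [ u ]) → E G x y
    glued-chain c with consecutive-split (u ∷ p) (subst (Consecutive _ _) cycle≡ c)
    ... | inj₁ c₁ = induced-consecutive π₁ c₁
    ... | inj₂ c₂ = induced-consecutive π₂ c₂

    glued-chordless : ∀ {x y} → x ∈ˡ u ∷ p ++ u′ ∷ q → y ∈ˡ u ∷ p ++ u′ ∷ q → E G x y →
      Consecutive x y (u ∷ (p ++ u′ ∷ q) ++ [ u ]) ⊎ Consecutive y x (u ∷ (p ++ u′ ∷ q) ++ [ u ])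
    glued-chordless x∈ y∈ e with same-side x∈ y∈ e
    ... | inj₁ (x₁ , y₁) = Sum.map back back (induced-chordless π₁ x₁ y₁ e)
      where
      back : ∀ {a b} → Consecutive a b (u ∷ p ++ [ u′ ]) → Consecutive a b (u ∷ (p ++ u′ ∷ q) ++ [ u ])
      back c = subst (Consecutive _ _) (sym cycle≡) (consecutive-glue (u ∷ p) c)
    ... | inj₂ (x₂ , y₂) = Sum.map back back (induced-chordless π₂ x₂ y₂ e)
      where
      back : ∀ {a b} → Consecutive a b (u′ ∷ q ++ [ u ]) → Consecutive a b (u ∷ (p ++ u′ ∷ q) ++ [ u ])
      back c = subst (Consecutive _ _) (sym cycle≡) (consecutive-++ʳ (u ∷ p) c)

    glued-unique : Unique (u ∷ p ++ u′ ∷ q)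
    glued-unique = Unique-++ (unique-++⁻ˡ (u ∷ p) (induced-unique π₁)) (unique-++⁻ˡ (u′ ∷ q) (induced-unique π₂)) disjoint
      where
      disjoint : ∀ {x} → x ∈ˡ u ∷ p × x ∈ˡ u′ ∷ q → ⊥
      disjoint (here refl , here refl)  = induced-head∉ π₁ (∈-++⁺ʳ p (here refl))
      disjoint (here refl , there u∈q)  = induced-last∉ q π₂ u∈q
      disjoint (there u′∈p , here refl) = induced-last∉ p π₁ u′∈p
      disjoint (there x∈p , there x∈q)  = p∩q=∅ x∈p x∈q

module ChordalGraphs {n : ℕ} (G : Graph n) (chordal : Chordal G) where
  open Graphs G
  open InducedPaths G

  no-long-induced-cycle : ∀ u vs → 3 ℕ.≤ length vs → Unique (u ∷ vs) →
    (∀ {x y} → Consecutive x y (u ∷ vs ++ [ u ]) → E G x y) →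
    (∀ {x y} → x ∈ˡ u ∷ vs → y ∈ˡ u ∷ vs → E G x y →
       Consecutive x y (u ∷ vs ++ [ u ]) ⊎ Consecutive y x (u ∷ vs ++ [ u ])) →
    ⊥
  no-long-induced-cycle u vs 3≤ unique chain chordless =
    chordal (length (u ∷ vs)) (s≤s 3≤) (List.lookup (u ∷ vs)) (injective , edges , induced)
    where
    f = List.lookup (u ∷ vs)
    injective : Injective _≡_ _≡_ f
    injective = lookup-injective unique
    edges : ∀ i j → CycNext G (length (u ∷ vs)) i j → E G (f i) (f j)
    edges i j      (inj₁ j≡1+i)     = chain (snoc-consecutive⁺ (u ∷ vs) j≡1+i)
    edges i fzero  (inj₂ (i-last , _)) = chain (snoc-consecutive-last (u ∷ vs) i-last)
    edges i (fsuc j) (inj₂ (_ , ()))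
    cycle-next : ∀ i j → Consecutive (f i) (f j) (u ∷ vs ++ [ u ]) → CycNext G (length (u ∷ vs)) i j
    cycle-next i j c with snoc-consecutive⁻ (u ∷ vs) c
    ... | i′ , fi′ , inj₁ (j′ , j′≡1+i′ , fj′) =
      inj₁ (subst₂ (λ a b → toℕ b ≡ suc (toℕ a)) (injective fi′) (injective fj′) j′≡1+i′)
    ... | i′ , fi′ , inj₂ (i′-last , fj≡u) =
      inj₂ (subst (λ a → suc (toℕ a) ≡ _) (injective fi′) i′-last , cong toℕ (injective {j} {fzero} fj≡u))
    induced : ∀ i j → E G (f i) (f j) → CycNext G (length (u ∷ vs)) i j ⊎ CycNext G (length (u ∷ vs)) j i
    induced i j e = Sum.map (cycle-next i j) (cycle-next j i) (chordless (∈-lookup i) (∈-lookup j) e)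

  -- glued together, the two paths form an induced cycle of length at least four
  no-hole : ∀ {u u′ p q} → InducedPath (u ∷ p ++ [ u′ ]) → InducedPath (u′ ∷ q ++ [ u ]) → p ≢ [] → q ≢ [] →
    (∀ {x} → x ∈ˡ p → x ∉ˡ q) → (∀ {x y} → x ∈ˡ p → y ∈ˡ q → ¬ E G x y) → ⊥
  no-hole {u} {u′} {p} {q} π₁ π₂ p≢[] q≢[] p∩q=∅ p≁q =
    no-long-induced-cycle u (p ++ u′ ∷ q) (length-++-∷≥3 p q p≢[] q≢[]) glued-unique glued-chain glued-chordless
    where open Glued π₁ π₂ p∩q=∅ p≁q

  Through : (Fin n → Bool) → Fin n → Fin n → Set
  Through P u u′ = Σ (Fin n) λ a → Σ (Fin n) λ b → E G u a × Path P a b × E G b u′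

  through-reverse : ∀ {P u u′} → Through P u u′ → Through P u′ u
  through-reverse (a , b , ua , p , bu′) = b , a , E-sym bu′ , path-reverse p , E-sym ua

  through-walk : ∀ {P u a b u′} → E G u a → Path P a b → E G b u′ →
    Σ (List (Fin n)) λ ws → Linked (E G) (u ∷ ws ++ [ u′ ]) × All (λ v → P v ≡ true) ws
  through-walk ua (here Pa) au′ = _ ∷ [] , ua ∷ au′ ∷ [-] , Pa ∷ []
  through-walk ua (step Pa ac p) bu′ with through-walk ac p bu′
  ... | ws , walk , Pws = _ ∷ ws , ua ∷ walk , Pa ∷ Pws

  induced-through : ∀ {P u u′} → u ≢ u′ → ¬ E G u u′ → Through P u u′ →
    Σ (List (Fin n)) λ p → InducedPath (u ∷ p ++ [ u′ ]) × p ≢ [] × All (λ v → P v ≡ true) p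
  induced-through u≢u′ ¬e (_ , _ , ua , p , bu′) with through-walk ua p bu′
  ... | ws , walk , Pws with induced-subpath ws walk u≢u′
  ...   | p , π , p⊆ws = p , π , nonempty π , All.tabulate (All.lookup Pws ∘ p⊆ws)
    where
    nonempty : ∀ {p} → InducedPath (_ ∷ p ++ [ _ ]) → p ≢ []
    nonempty π refl with π
    ... | extend _ e _ _ = ¬e e

  two-sided⇒adjacent : ∀ {P Q} → Disjointᵇ P Q → (∀ {a b} → P a ≡ true → Q b ≡ true → ¬ E G a b) →
    ∀ {u u′} → u ≢ u′ → Through P u u′ → Through Q u u′ → E G u u′
  two-sided⇒adjacent {P} {Q} P∩Q=∅ P≁Q {u} {u′} u≢u′ thP thQ with E? u u′
  ... | yes e = e
  ... | no ¬e with induced-through u≢u′ ¬e thP | induced-through (u≢u′ ∘ sym) (¬e ∘ E-sym) (through-reverse thQ)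
  ...   | p , π₁ , p≢[] , Pp | q , π₂ , q≢[] , Qq =
    ⊥-elim (no-hole π₁ π₂ p≢[] q≢[] (λ x∈p x∈q → P∩Q=∅ (All.lookup Pp x∈p) (All.lookup Qq x∈q))
                                     (λ x∈p y∈q → P≁Q (All.lookup Pp x∈p) (All.lookup Qq y∈q)))

  through-connected : ∀ {P} → Connectedᵇ P → ∀ {u u′} → NeighbourIn P u → NeighbourIn P u′ → Through P u u′
  through-connected P-conn (a , Pa , ua) (b , Pb , u′b) = a , b , ua , P-conn Pa Pb , E-sym u′b

  common-neighbours⇒adjacent : ∀ {P Q} → Connectedᵇ P → Connectedᵇ Q → Disjointᵇ P Q →
    (∀ {a b} → P a ≡ true → Q b ≡ true → ¬ E G a b) → ∀ {u u′} → u ≢ u′ →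
    NeighbourIn P u → NeighbourIn P u′ → NeighbourIn Q u → NeighbourIn Q u′ → E G u u′
  common-neighbours⇒adjacent P-conn Q-conn P∩Q=∅ P≁Q u≢u′ Pu Pu′ Qu Qu′ =
    two-sided⇒adjacent P∩Q=∅ P≁Q u≢u′ (through-connected P-conn Pu Pu′) (through-connected Q-conn Qu Qu′)

  degree-in : (Fin n → Bool) → Fin n → ℕ
  degree-in K c = Subset.∣ tabulate (λ σ → K σ ∧ Graph.adj G c σ) ∣

  -- walking from c towards σ, the first neighbour c′ of σ sees every neighbour of c in the clique K
  more-neighbours : ∀ {K C} → Cliqueᵇ K → Connectedᵇ C → Disjointᵇ C K →
    ∀ {c σ c₁} → C c ≡ true → K σ ≡ true → C c₁ ≡ true → E G σ c₁ → ¬ E G c σ →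
    Σ (Fin n) λ c′ → C c′ ≡ true × degree-in K c ℕ.< degree-in K c′
  more-neighbours {K} {C} K-clique C-conn C∩K=∅ {c} {σ} Cc Kσ Cc₁ σc₁ ¬cσ
    with path-exit (λ v → Graph.adj G v σ) (C-conn Cc Cc₁) (¬-not ¬cσ) (E-sym σc₁)
  ... | d , c′ , p , dc′ , Cc′ , c′σ =
    c′ , Cc′ , p⊂q⇒∣p∣<∣q∣ ((λ σ′∈ → ∈-tabulate⁺ (sees (∈-tabulate⁻ σ′∈)))
                          , σ , ∈-tabulate⁺ (∧⁺ Kσ c′σ) , σ∉)
    where
    σ∉ : σ Subset.∉ tabulate (λ σ′ → K σ′ ∧ Graph.adj G c σ′)
    σ∉ σ∈ = ¬cσ (proj₂ (∧⁻ (∈-tabulate⁻ σ∈)))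
    sees : ∀ {σ′} → (K σ′ ∧ Graph.adj G c σ′) ≡ true → (K σ′ ∧ Graph.adj G c′ σ′) ≡ true
    sees {σ′} h with ∧⁻ h
    ... | Kσ′ , cσ′ = ∧⁺ Kσ′ (E-sym (two-sided⇒adjacent disjoint apart σ′≢c′ (c , d , E-sym cσ′ , p , dc′)
                                                            (σ , σ , σ′σ , here (｛｝-self σ) , E-sym c′σ)))
      where
      disjoint : Disjointᵇ (λ v → C v ∧ not (Graph.adj G v σ)) ｛ σ ｝
      disjoint h₁ h₂ = C∩K=∅ (proj₁ (∧⁻ h₁)) (subst (λ u → K u ≡ true) (sym (｛｝-sound h₂)) Kσ)
      apart : ∀ {a b} → (C a ∧ not (Graph.adj G a σ)) ≡ true → ｛ σ ｝ b ≡ true → ¬ E G a b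
      apart h₁ h₂ e = not-¬ (subst (E G _) (｛｝-sound h₂) e) (not-injective (proj₂ (∧⁻ h₁)))
      σ′≢c′ : σ′ ≢ c′
      σ′≢c′ refl = C∩K=∅ Cc′ Kσ′
      σ′σ : E G σ′ σ
      σ′σ = K-clique Kσ′ Kσ λ { refl → ¬cσ cσ′ }

  full-vertex : ∀ {K C} → Cliqueᵇ K → Connectedᵇ C → Disjointᵇ C K → ∀ {y} → C y ≡ true →
    Σ (Fin n) λ c → C c ≡ true × (∀ {σ c′} → K σ ≡ true → C c′ ≡ true → E G σ c′ → E G c σ)
  full-vertex {K} {C} K-clique C-conn C∩K=∅ {y} Cy = c , Cc , full
    where
    candidates = filter (λ v → C v Bool.≟ true) (allFin n)
    c = argmax (degree-in K) y candidates
    Cc : C c ≡ true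
    Cc = argmax-all (degree-in K) {P = λ v → C v ≡ true} Cy (all-filter (λ v → C v Bool.≟ true) (allFin n))
    maximal : ∀ {c′} → C c′ ≡ true → degree-in K c′ ℕ.≤ degree-in K c
    maximal {c′} Cc′ = All.lookup (f[xs]≤f[argmax] y candidates) (∈-filter⁺ (λ v → C v Bool.≟ true) (∈-allFin c′) Cc′)
    full : ∀ {σ c′} → K σ ≡ true → C c′ ≡ true → E G σ c′ → E G c σ
    full {σ} Kσ Cc′ σc′ with E? c σ
    ... | yes e = e
    ... | no ¬e with more-neighbours K-clique C-conn C∩K=∅ Cc Kσ Cc′ σc′ ¬e
    ...   | c″ , Cc″ , more = ⊥-elim (ℕ.<⇒≱ more (maximal Cc″))

  four-cycle-chord : ∀ {x y z t} → x ≢ z → y ≢ t → E G x y → E G y z → E G z t → E G t x → ¬ E G y t → E G x z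
  four-cycle-chord {x} {y} {z} {t} x≢z y≢t xy yz zt tx ¬yt =
    two-sided⇒adjacent {｛ y ｝} {｛ t ｝}
      (λ {v} h h′ → y≢t (trans (sym (｛｝-sound {u = v} h)) (｛｝-sound h′)))
      (λ h h′ e → ¬yt (subst₂ (E G) (｛｝-sound h) (｛｝-sound h′) e))
      x≢z (y , y , xy , here (｛｝-self y) , yz) (t , t , E-sym tx , here (｛｝-self t) , E-sym zt)

  -- the neighbours of a component Y of G − F, where F is the closed neighbourhood of a connected set K, form a clique
  boundary-clique : ∀ {K F} → Connectedᵇ K → K ⊆ᵇ F → (∀ {u v} → K u ≡ true → E G u v → F v ≡ true) →
    (∀ {v} → F v ≡ true → K v ≡ false → NeighbourIn K v) →
    ∀ {y} (Y : Comprehension (Path (not ∘ F) y)) → Cliqueᵇ (λ v → not (Comprehension.set Y v) ∧ attached (Comprehension.set Y) v)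
  boundary-clique {K} {F} K-conn K⊆F K-step F-exact {y} Y {c} {c′} bc bc′ c≢c′ =
    common-neighbours⇒adjacent (reach-connected Y) K-conn Y∩K=∅ Y≁K c≢c′ (Y-nbr bc) (Y-nbr bc′) (K-nbr bc) (K-nbr bc′)
    where
    module Y = Comprehension Y
    ¬F : ∀ {v} → Y.set v ≡ true → F v ≡ false
    ¬F Yv = not-injective (reach⊆ Y Yv)
    Y∩K=∅ : Disjointᵇ Y.set K
    Y∩K=∅ Yv Kv = not-¬ (K⊆F Kv) (¬F Yv)
    Y≁K : ∀ {a b} → Y.set a ≡ true → K b ≡ true → ¬ E G a b
    Y≁K Ya Kb e = not-¬ (K-step Kb (E-sym e)) (¬F Ya)
    Y-nbr : ∀ {v} → (not (Y.set v) ∧ attached Y.set v) ≡ true → NeighbourIn Y.set v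
    Y-nbr h = attached⁻ (proj₂ (∧⁻ h))
    K-nbr : ∀ {v} → (not (Y.set v) ∧ attached Y.set v) ≡ true → NeighbourIn K v
    K-nbr {v} h with Y-nbr h
    ... | u , Yu , vu = F-exact Fv (¬-not λ Kv → Y≁K Yu Kv (E-sym vu))
      where
      Fv : F v ≡ true
      Fv = ¬-not λ ¬Fv → not-¬ (reach-closed Y Yu (cong not ¬Fv) (E-sym vu)) (not-injective (proj₁ (∧⁻ h)))

module WithinDistance {n : ℕ} (G : Graph n) where
  open Graphs G

  Near : ℕ → Fin n → Fin n → Set
  Near d x y = ∃[ l ] (l ℕ.≤ d × Walk G l x y)

  walk-++ : ∀ {l m x y z} → Walk G l x y → Walk G m y z → Walk G (l ℕ.+ m) x z
  walk-++ nil        w = w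
  walk-++ (cons e v) w = cons e (walk-++ v w)

  near-++ : ∀ {a b x y z} → Near a x y → Near b y z → Near (a ℕ.+ b) x z
  near-++ (l , l≤a , v) (m , m≤b , w) = l ℕ.+ m , ℕ.+-mono-≤ l≤a m≤b , walk-++ v w

  near-reverse : ∀ {d x y} → Near d x y → Near d y x
  near-reverse (l , l≤d , w) = l , l≤d , walk-reverse w

  near-refl : ∀ {d x} → Near d x x
  near-refl = 0 , z≤n , nil

  near-edge : ∀ {x y} → E G x y → Near 1 x y
  near-edge e = 1 , s≤s z≤n , cons e nil

  near? : ∀ d x y → Dec (Near d x y)
  near? zero x y with x Fin.≟ y
  ... | yes refl = yes near-refl
  ... | no x≢y   = no λ { (0 , _ , nil) → x≢y refl }
  near? (suc d) x y with x Fin.≟ y | Fin.any? (λ z → E? x z ×-dec near? d z y)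
  ... | yes refl | _                           = yes near-refl
  ... | no _     | yes (z , xz , l , l≤d , zy) = yes (suc l , s≤s l≤d , cons xz zy)
  ... | no x≢y   | no ∄z                       = no λ where
    (0 , _ , nil)                      → x≢y refl
    (suc l , s≤s l≤d , cons xz zy)     → ∄z (_ , xz , l , l≤d , zy)

  InBall : (Fin n → Bool) → ℕ → Fin n → Set
  InBall c k v = Σ (Fin n) λ c₀ → c c₀ ≡ true × Near k c₀ v

  module _ {c : Fin n → Bool} {k} (B : Comprehension (InBall c k)) where
    private module B = Comprehension B

    ball-centre : c ⊆ᵇ B.set
    ball-centre cv = B.complete (_ , cv , near-refl)

    ball-connected : Connectedᵇ c → Connectedᵇ B.set
    ball-connected c-conn Ba Bb with B.sound Ba | B.sound Bb
    ... | a₀ , ca₀ , l , l≤k , a₀a | b₀ , cb₀ , m , m≤k , b₀b =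
      path-reverse (along ca₀ nil a₀a l≤k) ++ᵖ path-map ball-centre (c-conn ca₀ cb₀) ++ᵖ along cb₀ nil b₀b m≤k
      where
      along : ∀ {c₀ i j a v} → c c₀ ≡ true → Walk G i c₀ a → Walk G j a v → i ℕ.+ j ℕ.≤ k → Path B.set a v
      along {i = i} cc₀ to-a nil i+0≤k = here (B.complete (_ , cc₀ , i , subst (ℕ._≤ k) (ℕ.+-identityʳ i) i+0≤k , to-a))
      along {i = i} {suc j} cc₀ to-a (cons e rest) i+j≤k =
        step (B.complete (_ , cc₀ , i , ℕ.≤-trans (ℕ.m≤m+n i (suc j)) i+j≤k , to-a)) e
             (along cc₀ (walk-snoc to-a e) rest (subst (ℕ._≤ k) (ℕ.+-suc i j) i+j≤k))

  module _ {c : Fin n → Bool} {k} (B : Comprehension (InBall c k)) (B′ : Comprehension (InBall c (suc k))) where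
    private
      module B  = Comprehension B
      module B′ = Comprehension B′

    ball-mono : B.set ⊆ᵇ B′.set
    ball-mono Bv with B.sound Bv
    ... | c₀ , cc₀ , l , l≤k , w = B′.complete (c₀ , cc₀ , l , ℕ.m≤n⇒m≤1+n l≤k , w)

    ball-step : ∀ {u v} → B.set u ≡ true → E G u v → B′.set v ≡ true
    ball-step Bu e with B.sound Bu
    ... | c₀ , cc₀ , l , l≤k , w = B′.complete (c₀ , cc₀ , suc l , s≤s l≤k , walk-snoc w e)

    ball-exact : ∀ {v} → B′.set v ≡ true → B.set v ≡ false → NeighbourIn B.set v
    ball-exact B′v ¬Bv with B′.sound B′v
    ... | c₀ , cc₀ , zero , _ , nil = ⊥-elim (not-¬ (B.complete (c₀ , cc₀ , near-refl)) ¬Bv)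
    ... | c₀ , cc₀ , suc l , s≤s l≤k , w with walk-unsnoc w
    ...   | u , w′ , uv = u , B.complete (c₀ , cc₀ , l , l≤k , w′) , E-sym uv

module _ {n : ℕ} (G : Graph n) where
  open Graphs G
  open WithinDistance G

  dominating-clique⇒diam≤3 : HasDominatingClique G → DiamAtMost3 G
  dominating-clique⇒diam≤3 (K , K-clique , K-dominating) x y =
    let (k , k∈K , kx) = to-K x ; (k′ , k′∈K , k′y) = to-K y
    in near-++ (near-reverse kx) (near-++ (within-K k∈K k′∈K) k′y)
    where
    to-K : ∀ v → Σ (Fin n) λ k → k ∈ K × Near 1 k v
    to-K v with v ∈? K
    ... | yes v∈K = v , v∈K , near-refl
    ... | no v∉K  = let (k , k∈K , kv) = K-dominating v v∉K in k , k∈K , near-edge kv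
    within-K : ∀ {a b} → a ∈ K → b ∈ K → Near 1 a b
    within-K {a} {b} a∈K b∈K with a Fin.≟ b
    ... | yes refl = near-refl
    ... | no a≢b   = near-edge (K-clique a b a∈K b∈K a≢b)

  dominating-clique? : Dec (HasDominatingClique G)
  dominating-clique? = anySubset? λ K →
      (Fin.all? λ x → Fin.all? λ y → (x ∈? K) →-dec ((y ∈? K) →-dec (¬? (x Fin.≟ y) →-dec E? x y)))
    ×-dec (Fin.all? λ v → ¬? (v ∈? K) →-dec Fin.any? λ u → (u ∈? K) ×-dec E? u v)

module GrowingCliques {n : ℕ} (G : Graph n) (connected : Connected G) (chordal : Chordal G) (diam≤3 : DiamAtMost3 G) where
  open Graphs G
  open ChordalGraphs G chordal

  module Round {K} (K-clique : Cliqueᵇ K) {y} (¬Ky : ¬ Dominates K y) (C : Comprehension (Path (not ∘ K) y)) where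
    module C = Comprehension C

    C-closed : ∀ {a b} → C.set a ≡ true → K b ≡ false → E G a b → C.set b ≡ true
    C-closed Ca Kb e = reach-closed C Ca (cong not Kb) e

    K-or-C : ∀ {a b} → C.set a ≡ true → E G a b → K b ≡ true ⊎ C.set b ≡ true
    K-or-C {b = b} Ca e with K b in Kb
    ... | true  = inj₁ refl
    ... | false = inj₂ (C-closed Ca Kb e)

    C∩K=∅ : Disjointᵇ C.set K
    C∩K=∅ Cv Kv = not-¬ Kv (not-injective (reach⊆ C Cv))

    Cy : C.set y ≡ true
    Cy = C.complete (here (cong not (¬-not (¬Ky ∘ inj₁))))

    y-neighbour∈C : ∀ {b} → E G b y → C.set b ≡ true
    y-neighbour∈C {b} e with K-or-C Cy (E-sym e)
    ... | inj₁ Kb = ⊥-elim (¬Ky (inj₂ (b , Kb , E-sym e)))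
    ... | inj₂ Cb = Cb

    full = full-vertex K-clique (reach-connected C) C∩K=∅ Cy
    c* = proj₁ full

    K′ : Fin n → Bool
    K′ σ = (K σ ∧ attached C.set σ) ∨ ｛ c* ｝ σ

    attached∈K′ : ∀ {σ c} → K σ ≡ true → C.set c ≡ true → E G σ c → K′ σ ≡ true
    attached∈K′ Kσ Cc σc = ∨⁺ˡ _ (∧⁺ Kσ (attached⁺ Cc σc))

    c*∈K′ : K′ c* ≡ true
    c*∈K′ = ∨⁺ʳ _ (｛｝-self c*)

    c*-sees : ∀ {σ} → (K σ ∧ attached C.set σ) ≡ true → E G c* σ
    c*-sees h with ∧⁻ h
    ... | Kσ , Aσ = let (c , Cc , σc) = attached⁻ Aσ in proj₂ (proj₂ full) Kσ Cc σc

    K′-clique : Cliqueᵇ K′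
    K′-clique {a} {b} K′a K′b a≢b with ∨⁻ (K a ∧ _) K′a | ∨⁻ (K b ∧ _) K′b
    ... | inj₁ Ka | inj₁ Kb = K-clique (proj₁ (∧⁻ Ka)) (proj₁ (∧⁻ Kb)) a≢b
    ... | inj₁ Ka | inj₂ b≡c* = subst (E G a) (sym (｛｝-sound b≡c*)) (E-sym (c*-sees Ka))
    ... | inj₂ a≡c* | inj₁ Kb = subst (λ v → E G v b) (sym (｛｝-sound a≡c*)) (c*-sees Kb)
    ... | inj₂ a≡c* | inj₂ b≡c* = ⊥-elim (a≢b (trans (｛｝-sound a≡c*) (sym (｛｝-sound b≡c*))))

    dominates-more : ∀ {v} → Dominates K v → Dominates K′ v
    dominates-more {v} (inj₁ Kv) with walk-exit C.set Cy (¬-not λ Cv → C∩K=∅ Cv Kv) (proj₂ (connected y v))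
    ... | a , σ₀ , Ca , ¬Cσ₀ , e with K-or-C Ca e
    ...   | inj₂ Cσ₀ = ⊥-elim (not-¬ Cσ₀ ¬Cσ₀)
    ...   | inj₁ Kσ₀ with v Fin.≟ σ₀
    ...     | yes refl = inj₁ (attached∈K′ Kσ₀ Ca (E-sym e))
    ...     | no v≢σ₀  = inj₂ (σ₀ , attached∈K′ Kσ₀ Ca (E-sym e) , K-clique Kv Kσ₀ v≢σ₀)
    dominates-more {v} (inj₂ (k , Kk , vk)) with K v Bool.≟ true | C.set v Bool.≟ true
    ... | yes Kv | _      = dominates-more (inj₁ Kv)
    ... | no ¬Kv | yes Cv = inj₂ (k , attached∈K′ Kk Cv (E-sym vk) , vk)
    ... | no ¬Kv | no ¬Cv = far (diam≤3 v y)
      where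
      Kv = ¬-not ¬Kv
      Cv = ¬-not ¬Cv
      -- the diameter bound: on a walk of length at most 3 from v ∉ C to y, the vertex after v is attached to C
      far : ∃[ l ] (l ℕ.≤ 3 × Walk G l v y) → Dominates K′ v
      far (0 , _ , nil)                     = ⊥-elim (not-¬ Cy Cv)
      far (1 , _ , cons vy nil)             = ⊥-elim (not-¬ (y-neighbour∈C vy) Cv)
      far (2 , _ , cons vp (cons py nil))   = ⊥-elim (not-¬ (C-closed (y-neighbour∈C py) Kv (E-sym vp)) Cv)
      far (3 , _ , cons {y = p₁} vp₁ (cons p₁p₂ (cons p₂y nil))) with K-or-C (y-neighbour∈C p₂y) (E-sym p₁p₂)
      ... | inj₁ Kp₁ = inj₂ (p₁ , attached∈K′ Kp₁ (y-neighbour∈C p₂y) p₁p₂ , vp₁)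
      ... | inj₂ Cp₁ = ⊥-elim (not-¬ (C-closed Cp₁ Kv (E-sym vp₁)) Cv)
      far (suc (suc (suc (suc _))) , s≤s (s≤s (s≤s ())) , _)

    shrinks : (C′ : Comprehension (Path (not ∘ K′) y)) →
      ∣ tabulate (Comprehension.set C′) ∣ ℕ.< ∣ tabulate C.set ∣
    shrinks C′ = p⊂q⇒∣p∣<∣q∣ ((λ v∈ → ∈-tabulate⁺ (C′⊆C (∈-tabulate⁻ v∈)))
                            , c* , ∈-tabulate⁺ (proj₁ (proj₂ full)) , c*∉C′)
      where
      module C′ = Comprehension C′
      closed : ClosedUnder C.set (not ∘ K′)
      closed Cu nK′w e with K-or-C Cu e
      ... | inj₁ Kw = ⊥-elim (not-¬ (attached∈K′ Kw Cu (E-sym e)) (not-injective nK′w))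
      ... | inj₂ Cw = Cw
      C′⊆C : C′.set ⊆ᵇ C.set
      C′⊆C h = path-closed closed Cy (C′.sound h)
      c*∉C′ : c* ∉ tabulate C′.set
      c*∉C′ c*∈ = not-¬ c*∈K′ (not-injective (reach⊆ C′ (∈-tabulate⁻ c*∈)))

  Grown : (Fin n → Bool) → Fin n → Set
  Grown K y = Σ (Fin n → Bool) λ K′ → Cliqueᵇ K′ × (∀ {v} → Dominates K v → Dominates K′ v) × Dominates K′ y

  grow : ∀ fuel {K} → Cliqueᵇ K → ∀ {y} → ¬ Dominates K y → (C : Comprehension (Path (not ∘ K) y)) →
    ∣ tabulate (Comprehension.set C) ∣ ℕ.< fuel → DoubleNegation (Grown K y)
  grow (suc fuel) {K} K-clique {y} ¬Ky C (s≤s size) = do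
      K′y? ← ¬¬-excluded-middle
      continue K′y?
    where
    open Round K-clique ¬Ky C
    continue : Dec (Dominates K′ y) → DoubleNegation (Grown K y)
    continue (yes K′y)  = pure {A = Grown K y} (K′ , K′-clique , dominates-more , K′y)
    continue (no ¬K′y) = do
      C′ ← ¬¬-comprehension (Path (not ∘ K′) y)
      (K″ , K″-clique , more , K″y) ← grow fuel K′-clique ¬K′y C′ (ℕ.<-≤-trans (shrinks C′) size)
      pure {A = Grown K y} (K″ , K″-clique , more ∘ dominates-more , K″y)

  CliqueDominating : List (Fin n) → Set
  CliqueDominating vs = Σ (Fin n → Bool) λ K → Cliqueᵇ K × All (Dominates K) vs

  dominate-all : ∀ vs → DoubleNegation (CliqueDominating vs)
  dominate-all []       = pure {A = CliqueDominating []} ((λ _ → false) , (λ ()) , [])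
  dominate-all (v ∷ vs) = do
      (K , K-clique , K-dom) ← dominate-all vs
      Kv? ← ¬¬-excluded-middle
      extend K-clique K-dom Kv?
    where
    extend : ∀ {K} → Cliqueᵇ K → All (Dominates K) vs → Dec (Dominates K v) → DoubleNegation (CliqueDominating (v ∷ vs))
    extend {K} K-clique K-dom (yes Kv) = pure {A = CliqueDominating (v ∷ vs)} (K , K-clique , Kv ∷ K-dom)
    extend {K} K-clique K-dom (no ¬Kv) = do
      C ← ¬¬-comprehension (Path (not ∘ K) v)
      (K′ , K′-clique , more , K′v) ← grow (suc n) K-clique ¬Kv C (s≤s (∣p∣≤n (tabulate (Comprehension.set C))))
      pure {A = CliqueDominating (v ∷ vs)} (K′ , K′-clique , K′v ∷ All.map more K-dom)

  diam≤3⇒dominating-clique : HasDominatingClique G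
  diam≤3⇒dominating-clique = decidable-stable (dominating-clique? G) do
    (K , K-clique , K-dom) ← dominate-all (allFin n)
    pure (tabulate K
         , (λ a b a∈K b∈K → K-clique (∈-tabulate⁻ a∈K) (∈-tabulate⁻ b∈K))
         , λ v v∉K → dominator (All.lookup K-dom (∈-allFin v)) v∉K)
    where
    dominator : ∀ {K v} → Dominates K v → v ∉ tabulate K → ∃[ u ] (u ∈ tabulate K × E G u v)
    dominator (inj₁ Kv)            v∉K = ⊥-elim (v∉K (∈-tabulate⁺ Kv))
    dominator (inj₂ (k , Kk , vk)) _   = k , ∈-tabulate⁺ Kk , E-sym vk

module SafeSetsWithDominatingClique {n : ℕ} (G : Graph n) (chordal : Chordal G)
  {K : Fin n → Bool} (K-clique : Graphs.Cliqueᵇ G K) (K-dominating : ∀ {v} → K v ≡ false → Graphs.NeighbourIn G K v)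
  {w : Fin n → ℚ} (w≥0 : NonNegative w) where
  open Graphs G
  open ChordalGraphs G chordal

  ConnSafeBelow : Subset n → Set
  ConnSafeBelow S = Σ (Subset n) λ T → IsConnSafe G w T × wt w T ≤ wt w S

  anchored⇒connected : ∀ {S} → (∀ {v} → S v ≡ true → Σ (Fin n) λ a → K a ≡ true × Path S a v) → Connectedᵇ S
  anchored⇒connected anchor Sx Sy with anchor Sx | anchor Sy
  ... | a , Ka , ax | b , Kb , by with a Fin.≟ b
  ...   | yes refl = path-reverse ax ++ᵖ by
  ...   | no a≢b   = path-reverse ax ++ᵖ step (path-start ax) (K-clique Ka Kb a≢b) by

  module Split (S : Subset n) (S-safe : IsSafe G w S) {b₀} (Kb₀ : K b₀ ≡ true) (Sb₀ : lookup S b₀ ≡ false)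
    {D₀ : Subset n} (D₀-comp : IsComponent G (∁ S) D₀) (b₀∈D₀ : b₀ ∈ D₀)
    (C₀ : Comprehension λ v → Σ (Fin n) λ a → K a ≡ true × Path (lookup S) a v) where
    module C₀ = Comprehension C₀

    Sᵇ D₀ᵇ : Fin n → Bool
    Sᵇ = lookup S
    D₀ᵇ = lookup D₀

    C₀⊆S : C₀.set ⊆ᵇ Sᵇ
    C₀⊆S h = path-end (proj₂ (proj₂ (C₀.sound h)))

    D₀∩S=∅ : ∀ {v} → D₀ᵇ v ≡ true → Sᵇ v ≡ false
    D₀∩S=∅ h = ∁-false S (component⊆ D₀-comp (lookup⇒∈ h))

    C₀-closed : ClosedUnder C₀.set Sᵇ
    C₀-closed Cu Sv e with C₀.sound Cu
    ... | a , Ka , au = C₀.complete (a , Ka , path-snoc au e Sv)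

    D₀-closed : ∀ {u v} → D₀ᵇ u ≡ true → Sᵇ v ≡ false → E G u v → D₀ᵇ v ≡ true
    D₀-closed Du ¬Sv e = ∈⇒lookup (component-reach D₀-comp (lookup⇒∈ Du)
                           (step (component⊆ D₀-comp (lookup⇒∈ Du)) e (here (∁-true S ¬Sv))))

    K∩S⊆C₀ : ∀ {a} → K a ≡ true → Sᵇ a ≡ true → C₀.set a ≡ true
    K∩S⊆C₀ Ka Sa = C₀.complete (_ , Ka , here Sa)

    K∖S⊆D₀ : ∀ {b} → K b ≡ true → Sᵇ b ≡ false → D₀ᵇ b ≡ true
    K∖S⊆D₀ {b} Kb ¬Sb with b₀ Fin.≟ b
    ... | yes refl = ∈⇒lookup b₀∈D₀
    ... | no b₀≢b  = D₀-closed (∈⇒lookup b₀∈D₀) ¬Sb (K-clique Kb₀ Kb b₀≢b)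

    P R : Fin n → Bool
    P v = Sᵇ v ∧ not (C₀.set v)
    R v = not (Sᵇ v) ∧ not (D₀ᵇ v)

    P-S : ∀ {v} → P v ≡ true → Sᵇ v ≡ true
    P-S = proj₁ ∘ ∧⁻

    P-C₀ : ∀ {v} → P v ≡ true → C₀.set v ≡ false
    P-C₀ = not-injective ∘ proj₂ ∘ ∧⁻

    R-S : ∀ {v} → R v ≡ true → Sᵇ v ≡ false
    R-S = not-injective ∘ proj₁ ∘ ∧⁻

    R-D₀ : ∀ {v} → R v ≡ true → D₀ᵇ v ≡ false
    R-D₀ = not-injective ∘ proj₂ ∘ ∧⁻

    P-attached : ∀ {p} → P p ≡ true → Σ (Fin n) λ b → K b ≡ true × Sᵇ b ≡ false × E G p b
    P-attached {p} Pp with K p Bool.≟ true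
    ... | yes Kp = ⊥-elim (not-¬ (K∩S⊆C₀ Kp (P-S Pp)) (P-C₀ Pp))
    ... | no ¬Kp with K-dominating (¬-not ¬Kp)
    ...   | b , Kb , pb with Sᵇ b Bool.≟ true
    ...     | yes Sb = ⊥-elim (not-¬ (C₀-closed (K∩S⊆C₀ Kb Sb) (P-S Pp) (E-sym pb)) (P-C₀ Pp))
    ...     | no ¬Sb = b , Kb , ¬-not ¬Sb , pb

    R-attached : ∀ {r} → R r ≡ true → Σ (Fin n) λ a → K a ≡ true × Sᵇ a ≡ true × E G r a
    R-attached {r} Rr with K r Bool.≟ true
    ... | yes Kr = ⊥-elim (not-¬ (K∖S⊆D₀ Kr (R-S Rr)) (R-D₀ Rr))
    ... | no ¬Kr with K-dominating (¬-not ¬Kr)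
    ...   | a , Ka , ra with Sᵇ a Bool.≟ true
    ...     | yes Sa = a , Ka , Sa , ra
    ...     | no ¬Sa = ⊥-elim (not-¬ (D₀-closed (K∖S⊆D₀ Ka (¬-not ¬Sa)) (R-S Rr) (E-sym ra)) (R-D₀ Rr))

    -- an edge p r would close the 4-cycle p b a r through K
    P≁R : ∀ {p r} → P p ≡ true → R r ≡ true → ¬ E G p r
    P≁R {p} {r} Pp Rr pr with P-attached Pp | R-attached Rr
    ... | b , Kb , ¬Sb , pb | a , Ka , Sa , ra =
      not-¬ (C₀-closed (K∩S⊆C₀ Ka Sa) (P-S Pp) (E-sym (four-cycle-chord p≢a b≢r pb ba (E-sym ra) (E-sym pr) ¬br))) (P-C₀ Pp)
      where
      p≢a : p ≢ a
      p≢a refl = not-¬ (K∩S⊆C₀ Ka Sa) (P-C₀ Pp)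
      b≢r : b ≢ r
      b≢r refl = not-¬ (K∖S⊆D₀ Kb ¬Sb) (R-D₀ Rr)
      ba : E G b a
      ba = K-clique Kb Ka λ { refl → not-¬ Sa ¬Sb }
      ¬br : ¬ E G b r
      ¬br e = not-¬ (D₀-closed (K∖S⊆D₀ Kb ¬Sb) (R-S Rr) e) (R-D₀ Rr)

    P-closed : ClosedUnder P Sᵇ
    P-closed Pu Sv e = ∧⁺ Sv (cong not (¬-not λ C₀v → not-¬ (C₀-closed C₀v (P-S Pu) (E-sym e)) (P-C₀ Pu)))

    R-closed : ClosedUnder R (not ∘ Sᵇ)
    R-closed Ru ¬Sv e = ∧⁺ ¬Sv (cong not (¬-not λ D₀v → not-¬ (D₀-closed D₀v (R-S Ru) (E-sym e)) (R-D₀ Ru)))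

    D₀-light : ∀ {Q} → IsComponent G S Q → ∀ {p} → p ∈ Q → P p ≡ true → wt w D₀ ≤ wt w Q
    D₀-light Q-comp {p} p∈Q Pp with P-attached Pp
    ... | b , Kb , ¬Sb , pb = proj₂ S-safe _ _ Q-comp D₀-comp (p , b , p∈Q , lookup⇒∈ (K∖S⊆D₀ Kb ¬Sb) , pb)

    R-light : ∀ {Z} → IsComponent G (∁ S) Z → ∀ {r} → r ∈ Z → R r ≡ true → wt w Z ≤ Wt w C₀.set
    R-light {Z} Z-comp {r} r∈Z Rr with R-attached Rr
    ... | a , Ka , Sa , ra = decidable-stable (_ ℚ.≤? _) do
      (A , A-comp , a∈A) ← ¬¬-component S Sa
      pure (ℚ.≤-trans (proj₂ S-safe A Z A-comp Z-comp (a , r , a∈A , r∈Z , E-sym ra))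
                      (Wt-mono w≥0 λ Av → C₀.complete (a , Ka , component-path A-comp a∈A (lookup⇒∈ Av))))

    R-vertex-light : ∀ {r} → R r ≡ true → w r ≤ Wt w C₀.set
    R-vertex-light Rr = decidable-stable (_ ℚ.≤? _) do
      (Z , Z-comp , r∈Z) ← ¬¬-component (∁ S) (∁-true S (R-S Rr))
      pure (ℚ.≤-trans (≤-Wt w≥0 (∈⇒lookup r∈Z)) (R-light Z-comp r∈Z Rr))

    module Candidate (Y X : Fin n → Bool) (Y⊆P : Y ⊆ᵇ P) (X⊆R : X ⊆ᵇ R) where

      T : Fin n → Bool
      T v = (C₀.set v ∨ D₀ᵇ v) ∨ (Y v ∨ X v)

      Wt-T : Wt w T ≡ (Wt w C₀.set + Wt w D₀ᵇ) + (Wt w Y + Wt w X)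
      Wt-T = trans (Wt-∨ w C₀D₀∩YX=∅) (cong₂ _+_ (Wt-∨ w C₀∩D₀=∅) (Wt-∨ w Y∩X=∅))
        where
        C₀∩D₀=∅ : Disjointᵇ C₀.set D₀ᵇ
        C₀∩D₀=∅ C₀v D₀v = not-¬ (C₀⊆S C₀v) (D₀∩S=∅ D₀v)
        Y∩X=∅ : Disjointᵇ Y X
        Y∩X=∅ Yv Xv = not-¬ (P-S (Y⊆P Yv)) (R-S (X⊆R Xv))
        C₀D₀∩YX=∅ : Disjointᵇ (λ v → C₀.set v ∨ D₀ᵇ v) (λ v → Y v ∨ X v)
        C₀D₀∩YX=∅ {v} h h′ with ∨⁻ (C₀.set v) h | ∨⁻ (Y v) h′
        ... | inj₁ C₀v | inj₁ Yv = not-¬ C₀v (P-C₀ (Y⊆P Yv))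
        ... | inj₁ C₀v | inj₂ Xv = not-¬ (C₀⊆S C₀v) (R-S (X⊆R Xv))
        ... | inj₂ D₀v | inj₁ Yv = not-¬ (P-S (Y⊆P Yv)) (D₀∩S=∅ D₀v)
        ... | inj₂ D₀v | inj₂ Xv = not-¬ D₀v (R-D₀ (X⊆R Xv))

      C₀⊆T : C₀.set ⊆ᵇ T
      C₀⊆T {v} h = ∨⁺ˡ _ (∨⁺ˡ _ h)

      D₀⊆T : D₀ᵇ ⊆ᵇ T
      D₀⊆T {v} h = ∨⁺ˡ _ (∨⁺ʳ (C₀.set v) h)

      to-C₀ : ∀ {v} → C₀.set v ≡ true → Path T b₀ v
      to-C₀ C₀v with C₀.sound C₀v
      ... | a , Ka , av = step (D₀⊆T (∈⇒lookup b₀∈D₀)) (K-clique Kb₀ Ka λ { refl → not-¬ (path-start av) Sb₀ })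
                               (path-map C₀⊆T (path-lift C₀-closed (K∩S⊆C₀ Ka (path-start av)) av))

      to-D₀ : ∀ {v} → D₀ᵇ v ≡ true → Path T b₀ v
      to-D₀ D₀v = path-map D₀⊆T (component-connected D₀-comp (∈⇒lookup b₀∈D₀) D₀v)

      T-connected : Connectedᵇ T
      T-connected = rooted⇒connected from-b₀
        where
        from-b₀ : ∀ {v} → T v ≡ true → Path T b₀ v
        from-b₀ {v} Tv with ∨⁻ (C₀.set v ∨ D₀ᵇ v) Tv
        ... | inj₁ h with ∨⁻ (C₀.set v) h
        ...   | inj₁ C₀v = to-C₀ C₀v
        ...   | inj₂ D₀v = to-D₀ D₀v
        from-b₀ {v} Tv | inj₂ h with ∨⁻ (Y v) h
        ...   | inj₁ Yv = let (b , Kb , ¬Sb , vb) = P-attached (Y⊆P Yv) in path-snoc (to-D₀ (K∖S⊆D₀ Kb ¬Sb)) (E-sym vb) Tv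
        ...   | inj₂ Xv = let (a , Ka , Sa , va) = R-attached (X⊆R Xv) in path-snoc (to-C₀ (K∩S⊆C₀ Ka Sa)) (E-sym va) Tv

      ∁T⁻ : ∀ {v} → lookup (∁ (tabulate T)) v ≡ true → T v ≡ false
      ∁T⁻ {v} h = trans (sym (Vec.lookup∘tabulate T v)) (∁-false (tabulate T) h)

      ∉T : ∀ {v} → lookup (∁ (tabulate T)) v ≡ true → C₀.set v ≡ false × D₀ᵇ v ≡ false × Y v ≡ false × X v ≡ false
      ∉T {v} h with ∨-false⁻ {C₀.set v ∨ D₀ᵇ v} (∁T⁻ h)
      ... | ¬C₀D₀ , ¬YX with ∨-false⁻ {C₀.set v} ¬C₀D₀ | ∨-false⁻ {Y v} ¬YX
      ...   | ¬C₀ , ¬D₀ | ¬Y , ¬X = ¬C₀ , ¬D₀ , ¬Y , ¬X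

      within-P : ∀ {D d} → IsComponent G (∁ (tabulate T)) D → d ∈ D → P d ≡ true →
        ∀ {Q} → IsComponent G S Q → d ∈ Q → lookup D ⊆ᵇ lookup Q
      within-P D-comp d∈D Pd {Q} Q-comp d∈Q Dz = component-within D-comp closed d∈D (∈⇒lookup d∈Q) (lookup⇒∈ Dz)
        where
        Q⊆P : lookup Q ⊆ᵇ P
        Q⊆P Qv = component-within Q-comp P-closed d∈Q Pd (lookup⇒∈ Qv)
        closed : ClosedUnder (lookup Q) (lookup (∁ (tabulate T)))
        closed {u} {v} Qu ∁Tv e with Sᵇ v Bool.≟ true
        ... | yes Sv = ∈⇒lookup (component-reach Q-comp (lookup⇒∈ Qu) (step (component⊆ Q-comp (lookup⇒∈ Qu)) e (here Sv)))
        ... | no ¬Sv = ⊥-elim (P≁R (Q⊆P Qu) (∧⁺ (cong not (¬-not ¬Sv)) (cong not (proj₁ (proj₂ (∉T ∁Tv))))) e)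

      within-R : ∀ {D d} → IsComponent G (∁ (tabulate T)) D → d ∈ D → R d ≡ true →
        ∀ {Z} → IsComponent G (∁ S) Z → d ∈ Z → lookup D ⊆ᵇ lookup Z
      within-R D-comp d∈D Rd {Z} Z-comp d∈Z Dz = component-within D-comp closed d∈D (∈⇒lookup d∈Z) (lookup⇒∈ Dz)
        where
        Z⊆R : lookup Z ⊆ᵇ R
        Z⊆R Zv = component-within Z-comp (λ Ru ∁Sv e → R-closed Ru (cong not (∁-false S ∁Sv)) e) d∈Z Rd (lookup⇒∈ Zv)
        closed : ClosedUnder (lookup Z) (lookup (∁ (tabulate T)))
        closed {u} {v} Zu ∁Tv e with Sᵇ v Bool.≟ true
        ... | yes Sv = ⊥-elim (P≁R (∧⁺ Sv (cong not (proj₁ (∉T ∁Tv)))) (Z⊆R Zu) (E-sym e))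
        ... | no ¬Sv = ∈⇒lookup (component-reach Z-comp (lookup⇒∈ Zu)
                         (step (component⊆ Z-comp (lookup⇒∈ Zu)) e (here (∁-true S (¬-not ¬Sv)))))

      T-safe : (∀ {Q} → IsComponent G S Q → ∀ {p} → p ∈ Q → P p ≡ true → Y p ≡ false → wt w Q ≤ Wt w T) →
        IsConnSafe G w (tabulate T)
      T-safe P-bound = connected-safe w≥0 T (D₀⊆T (∈⇒lookup b₀∈D₀)) T-connected light
        where
        light : ∀ D → IsComponent G (∁ (tabulate T)) D → wt w D ≤ Wt w T
        light D D-comp with proj₁ D-comp
        ... | d , d∈D with ∉T (component⊆ D-comp d∈D) | Sᵇ d Bool.≟ true
        ...   | ¬C₀d , ¬D₀d , ¬Yd , _ | yes Sd = decidable-stable (_ ℚ.≤? _) do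
                  (Q , Q-comp , d∈Q) ← ¬¬-component S Sd
                  pure (ℚ.≤-trans (Wt-mono w≥0 (within-P D-comp d∈D Pd Q-comp d∈Q)) (P-bound Q-comp d∈Q Pd ¬Yd))
          where
          Pd = ∧⁺ Sd (cong not ¬C₀d)
        ...   | ¬C₀d , ¬D₀d , _ | no ¬Sd = decidable-stable (_ ℚ.≤? _) do
                  (Z , Z-comp , d∈Z) ← ¬¬-component (∁ S) (∁-true S (¬-not ¬Sd))
                  pure (ℚ.≤-trans (Wt-mono w≥0 (within-R D-comp d∈D Rd Z-comp d∈Z))
                         (ℚ.≤-trans (R-light Z-comp d∈Z Rd) (Wt-mono w≥0 C₀⊆T)))
          where
          Rd = ∧⁺ (cong not (¬-not ¬Sd)) (cong not ¬D₀d)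

    module Improve {Q : Subset n} (Q-comp : IsComponent G S Q) {p₀} (p₀∈Q : p₀ ∈ Q) (Pp₀ : P p₀ ≡ true) where

      Q⊆P : lookup Q ⊆ᵇ P
      Q⊆P Qv = component-within Q-comp P-closed p₀∈Q Pp₀ (lookup⇒∈ Qv)

      P∖Q : Fin n → Bool
      P∖Q v = P v ∧ not (lookup Q v)

      P∖Q⊆P : P∖Q ⊆ᵇ P
      P∖Q⊆P = proj₁ ∘ ∧⁻

      base : ℚ
      base = (Wt w C₀.set + Wt w D₀ᵇ) + Wt w P∖Q

      module OffQ = Candidate P∖Q R P∖Q⊆P (λ Rv → Rv)

      off-Q-weight : Wt w (not ∘ lookup Q) ≤ base + Wt w R
      off-Q-weight = ℚ.≤-trans (Wt-mono w≥0 off-Q⊆)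
        (ℚ.≤-reflexive (trans OffQ.Wt-T (sym (ℚ.+-assoc (Wt w C₀.set + Wt w D₀ᵇ) (Wt w P∖Q) (Wt w R)))))
        where
        off-Q⊆ : (not ∘ lookup Q) ⊆ᵇ OffQ.T
        off-Q⊆ {v} ¬Qv with Sᵇ v Bool.≟ true | C₀.set v Bool.≟ true | D₀ᵇ v Bool.≟ true
        ... | _      | yes C₀v | _      = OffQ.C₀⊆T C₀v
        ... | _      | _       | yes D₀v = OffQ.D₀⊆T D₀v
        ... | yes Sv | no ¬C₀v | no _    = ∨⁺ʳ (C₀.set v ∨ D₀ᵇ v) (∨⁺ˡ _ (∧⁺ (∧⁺ Sv (cong not (¬-not ¬C₀v))) ¬Qv))
        ... | no ¬Sv | no _    | no ¬D₀v =
          ∨⁺ʳ (C₀.set v ∨ D₀ᵇ v) (∨⁺ʳ (P∖Q v) (∧⁺ (cong not (¬-not ¬Sv)) (cong not (¬-not ¬D₀v))))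

      Q-weight≤S : Wt w C₀.set + (Wt w (lookup Q) + Wt w P∖Q) ≤ wt w S
      Q-weight≤S = ℚ.≤-trans (ℚ.≤-reflexive (sym (trans (Wt-∨ w C₀∩QP∖Q=∅) (cong (Wt w C₀.set +_) (Wt-∨ w Q∩P∖Q=∅)))))
                             (Wt-mono w≥0 ⊆S)
        where
        Q∩P∖Q=∅ : Disjointᵇ (lookup Q) P∖Q
        Q∩P∖Q=∅ Qv P∖Qv = not-¬ Qv (not-injective (proj₂ (∧⁻ P∖Qv)))
        C₀∩QP∖Q=∅ : Disjointᵇ C₀.set (λ v → lookup Q v ∨ P∖Q v)
        C₀∩QP∖Q=∅ {v} C₀v h with ∨⁻ (lookup Q v) h
        ... | inj₁ Qv   = not-¬ C₀v (P-C₀ (Q⊆P Qv))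
        ... | inj₂ P∖Qv = not-¬ C₀v (P-C₀ (P∖Q⊆P P∖Qv))
        ⊆S : (λ v → C₀.set v ∨ (lookup Q v ∨ P∖Q v)) ⊆ᵇ Sᵇ
        ⊆S {v} h with ∨⁻ (C₀.set v) h
        ... | inj₁ C₀v = C₀⊆S C₀v
        ... | inj₂ h′ with ∨⁻ (lookup Q v) h′
        ...   | inj₁ Qv   = P-S (Q⊆P Qv)
        ...   | inj₂ P∖Qv = P-S (P∖Q⊆P P∖Qv)

      -- Q outweighs its complement, so Q alone is a connected safe set
      heavy : base + Wt w R < wt w Q → ConnSafeBelow S
      heavy heavy-Q = Q , subst (IsConnSafe G w) (Vec.tabulate∘lookup Q) Q-safe , Wt-mono w≥0 (component⊆ Q-comp ∘ lookup⇒∈)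
        where
        Q-safe : IsConnSafe G w (tabulate (lookup Q))
        Q-safe = connected-safe w≥0 (lookup Q) (∈⇒lookup p₀∈Q) (component-connected Q-comp) λ D D-comp →
          ℚ.<⇒≤ (ℚ.≤-<-trans (ℚ.≤-trans (Wt-mono w≥0 (off-Q D-comp)) off-Q-weight) heavy-Q)
          where
          off-Q : ∀ {D} → IsComponent G (∁ (tabulate (lookup Q))) D → lookup D ⊆ᵇ (not ∘ lookup Q)
          off-Q {D} D-comp {v} Dv =
            cong not (trans (sym (Vec.lookup∘tabulate (lookup Q) v)) (∁-false (tabulate (lookup Q)) (component⊆ D-comp (lookup⇒∈ Dv))))

      -- otherwise add to C₀ ∪ D₀ ∪ (P ∖ Q) just enough of R to outweigh Q
      light : wt w Q ≤ base + Wt w R → ConnSafeBelow S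
      light Q≤ with greedy-subset R R-vertex-light (D₀-light Q-comp p₀∈Q Pp₀) D₀+C₀≤base Q≤
        where
        D₀+C₀≤base : Wt w D₀ᵇ + Wt w C₀.set ≤ base
        D₀+C₀≤base = ℚ.≤-trans (ℚ.≤-reflexive (ℚ.+-comm (Wt w D₀ᵇ) (Wt w C₀.set))) (p≤p+q _ (Wt-nonNeg w≥0 P∖Q))
      ... | X , X⊆R , Q≤T , D₀X≤Q = tabulate T , T-safe P-bound , T≤S
        where
        open Candidate P∖Q X P∖Q⊆P X⊆R
        Wt-T′ : Wt w T ≡ base + Wt w X
        Wt-T′ = trans Wt-T (sym (ℚ.+-assoc (Wt w C₀.set + Wt w D₀ᵇ) (Wt w P∖Q) (Wt w X)))
        P-bound : ∀ {Q′} → IsComponent G S Q′ → ∀ {p} → p ∈ Q′ → P p ≡ true → P∖Q p ≡ false → wt w Q′ ≤ Wt w T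
        P-bound {Q′} Q′-comp p∈Q′ Pp ¬P∖Qp =
          ℚ.≤-trans (Wt-mono w≥0 Q′⊆Q) (ℚ.≤-trans Q≤T (ℚ.≤-reflexive (sym Wt-T′)))
          where
          Qp = ¬-not λ ¬Qp → not-¬ (∧⁺ Pp (cong not ¬Qp)) ¬P∖Qp
          Q′⊆Q : lookup Q′ ⊆ᵇ lookup Q
          Q′⊆Q Q′v = ∈⇒lookup (component-reach Q-comp (lookup⇒∈ Qp) (component-path Q′-comp p∈Q′ (lookup⇒∈ Q′v)))
        T≤S : wt w (tabulate T) ≤ wt w S
        T≤S = begin
          wt w (tabulate T)                                   ≡⟨ trans (Wt-tabulate w T) Wt-T ⟩
          (Wt w C₀.set + Wt w D₀ᵇ) + (Wt w P∖Q + Wt w X)      ≡⟨ regroup (Wt w C₀.set) (Wt w D₀ᵇ) (Wt w P∖Q) (Wt w X) ⟩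
          Wt w C₀.set + ((Wt w D₀ᵇ + Wt w X) + Wt w P∖Q)      ≤⟨ ℚ.+-monoʳ-≤ (Wt w C₀.set) (ℚ.+-monoˡ-≤ (Wt w P∖Q) D₀X≤Q) ⟩
          Wt w C₀.set + (Wt w (lookup Q) + Wt w P∖Q)          ≤⟨ Q-weight≤S ⟩
          wt w S                                              ∎
          where
          open ℚ.≤-Reasoning
          regroup : ∀ a b c d → (a + b) + (c + d) ≡ a + ((b + d) + c)
          regroup a b c d = trans (ℚ.+-assoc a b (c + d)) (cong (a +_) (x∙yz≈xz∙y b c d))

      improvement : ConnSafeBelow S
      improvement with wt w Q ℚ.≤? base + Wt w R
      ... | yes Q≤ = light Q≤
      ... | no Q≰  = heavy (ℚ.≰⇒> Q≰)

    improve : ¬ Connectedᵇ Sᵇ → DoubleNegation (ConnSafeBelow S)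
    improve ¬S-conn with Fin.any? (λ p → P p Bool.≟ true)
    ... | yes (p₀ , Pp₀) = do
      (Q , Q-comp , p₀∈Q) ← ¬¬-component S (P-S Pp₀)
      pure (Improve.improvement Q-comp p₀∈Q Pp₀)
    ... | no ∄p = ⊥-elim (¬S-conn (anchored⇒connected (C₀.sound ∘ S⊆C₀)))
      where
      S⊆C₀ : Sᵇ ⊆ᵇ C₀.set
      S⊆C₀ {v} Sv = ¬-not λ ¬C₀v → ∄p (v , ∧⁺ Sv (cong not ¬C₀v))

  connected-safe-below : ∀ {S} → IsSafe G w S → DoubleNegation (ConnSafeBelow S)
  connected-safe-below {S} S-safe = do
      S-conn? ← ¬¬-excluded-middle
      split S-conn?
    where
    split : Dec (Connectedᵇ (lookup S)) → DoubleNegation (ConnSafeBelow S)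
    split (yes S-conn) = pure {A = ConnSafeBelow S}
      (S , (S-safe , λ x y x∈S y∈S → toPathIn (S-conn (∈⇒lookup x∈S) (∈⇒lookup y∈S))) , ℚ.≤-refl)
    split (no ¬S-conn) with Fin.any? (λ b → (K b Bool.≟ true) ×-dec (lookup S b Bool.≟ false))
    ... | no ∄b = ⊥-elim (¬S-conn (anchored⇒connected anchor))
      where
      anchor : ∀ {v} → lookup S v ≡ true → Σ (Fin n) λ a → K a ≡ true × Path (lookup S) a v
      anchor {v} Sv with K v Bool.≟ true
      ... | yes Kv = v , Kv , here Sv
      ... | no ¬Kv with K-dominating (¬-not ¬Kv)
      ...   | a , Ka , va = a , Ka , step (¬-not λ ¬Sa → ∄b (a , Ka , ¬Sa)) (E-sym va) (here Sv)
    ... | yes (b₀ , Kb₀ , Sb₀) = do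
      (D₀ , D₀-comp , b₀∈D₀) ← ¬¬-component (∁ S) (∁-true S Sb₀)
      C₀ ← ¬¬-comprehension _
      Split.improve S S-safe Kb₀ Sb₀ D₀-comp b₀∈D₀ C₀ ¬S-conn

dominating-clique⇒Gcs : ∀ {n} (G : Graph n) → Chordal G → HasDominatingClique G → InGcs G
dominating-clique⇒Gcs G chordal (K , K-clique , K-dominating) w w>0 _ _ ((S₀ , S₀-safe , refl) , s-min) ((T₀ , T₀-cs , refl) , cs-min) =
  decidable-stable (_ ℚ.≟ _) do
    (T , T-cs , T≤S₀) ← connected-safe-below S₀-safe
    pure (ℚ.≤-antisym (s-min T₀ (proj₁ T₀-cs)) (ℚ.≤-trans (cs-min T T-cs) T≤S₀))
  where
  open Graphs G
  K-clique′ : Cliqueᵇ (lookup K)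
  K-clique′ Ka Kb = K-clique _ _ (lookup⇒∈ Ka) (lookup⇒∈ Kb)
  K-dominating′ : ∀ {v} → lookup K v ≡ false → NeighbourIn (lookup K) v
  K-dominating′ {v} ¬Kv with K-dominating v (λ v∈K → not-¬ (∈⇒lookup v∈K) ¬Kv)
  ... | u , u∈K , uv = u , ∈⇒lookup u∈K , E-sym uv
  w≥0 : NonNegative w
  w≥0 v = ℚ.<⇒≤ (w>0 v)
  open SafeSetsWithDominatingClique G chordal K-clique′ K-dominating′ w≥0

subsets : ∀ n → List (Subset n)
subsets zero    = Vec.[] ∷ []
subsets (suc n) = List.map (true Vec.∷_) (subsets n) ++ List.map (false Vec.∷_) (subsets n)

∈-subsets : ∀ {n} (S : Subset n) → S ∈ˡ subsets n
∈-subsets Vec.[]            = here refl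
∈-subsets (true Vec.∷ S)  = ∈-++⁺ˡ (∈-map⁺ (true Vec.∷_) (∈-subsets S))
∈-subsets (false Vec.∷ S) = ∈-++⁺ʳ _ (∈-map⁺ (false Vec.∷_) (∈-subsets S))

¬¬-minimum : ∀ {A : Set} (f : A → ℚ) (P : A → Set) (xs : List A) →
  DoubleNegation ((∀ {a} → a ∈ˡ xs → ¬ P a) ⊎ Σ A λ b → P b × (∀ {a} → a ∈ˡ xs → P a → f b ≤ f a))
¬¬-minimum f P []       = pure (inj₁ λ ())
¬¬-minimum f P (x ∷ xs) = do
    m ← ¬¬-minimum f P xs
    Px? ← ¬¬-excluded-middle
    pure (add m Px?)
  where
  add : (∀ {a} → a ∈ˡ xs → ¬ P a) ⊎ Σ _ (λ b → P b × (∀ {a} → a ∈ˡ xs → P a → f b ≤ f a)) → Dec (P x) →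
    (∀ {a} → a ∈ˡ x ∷ xs → ¬ P a) ⊎ Σ _ (λ b → P b × (∀ {a} → a ∈ˡ x ∷ xs → P a → f b ≤ f a))
  add (inj₁ none)          (no ¬Px) = inj₁ λ { (here refl) → ¬Px ; (there a∈) → none a∈ }
  add (inj₁ none)          (yes Px) = inj₂ (x , Px , λ { (here refl) _ → ℚ.≤-refl ; (there a∈) Pa → ⊥-elim (none a∈ Pa) })
  add (inj₂ (b , Pb , min)) (no ¬Px) = inj₂ (b , Pb , λ { (here refl) Pa → ⊥-elim (¬Px Pa) ; (there a∈) → min a∈ })
  add (inj₂ (b , Pb , min)) (yes Px) with f b ℚ.≤? f x
  ... | yes b≤x = inj₂ (b , Pb , λ { (here refl) _ → b≤x ; (there a∈) → min a∈ })
  ... | no  b≰x = inj₂ (x , Px , λ { (here refl) _ → ℚ.≤-refl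
                                   ; (there a∈) Pa → ℚ.≤-trans (ℚ.<⇒≤ (ℚ.≰⇒> b≰x)) (min a∈ Pa) })

¬¬-min-weight : ∀ {n} (w : Fin n → ℚ) (P : Subset n → Set) → Σ (Subset n) P → DoubleNegation (Σ ℚ (IsMinWeight w P))
¬¬-min-weight {n} w P (S , PS) = do
  m ← ¬¬-minimum (wt w) P (subsets n)
  pure (from m)
  where
  from : (∀ {a} → a ∈ˡ subsets n → ¬ P a) ⊎ Σ _ (λ b → P b × (∀ {a} → a ∈ˡ subsets n → P a → wt w b ≤ wt w a)) →
    Σ ℚ (IsMinWeight w P)
  from (inj₁ none)          = ⊥-elim (none (∈-subsets S) PS)
  from (inj₂ (T , PT , min)) = wt w T , (T , PT , refl) , λ S′ PS′ → min (∈-subsets S′) PS′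

module Separations {n : ℕ} (G : Graph n) where
  open Graphs G

  record Side : Set where
    field
      inner boundary     : Fin n → Bool
      p q                : Fin n
      inner-p            : inner p ≡ true
      boundary-q         : boundary q ≡ true
      pq                 : E G p q
      inner∩boundary=∅   : Disjointᵇ inner boundary
      boundary-clique    : Cliqueᵇ boundary
      inner-closed       : ∀ {u v} → inner u ≡ true → E G u v → inner v ≡ true ⊎ boundary v ≡ true
      zone-connected     : Connectedᵇ (λ v → inner v ∨ boundary v)

    zone : Fin n → Bool
    zone v = inner v ∨ boundary v

  record Separation : Set where
    field
      left right : Side
      disjoint   : Disjointᵇ (Side.zone left) (Side.zone right)
      apart      : ∀ {u v} → Side.zone left u ≡ true → Side.zone right v ≡ true → ¬ E G u v

module SeparationWeights {n : ℕ} (G : Graph n) (connected : Connected G) (sep : Separations.Separation G) where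
  open Graphs G
  open Separations G
  open Separation sep
  open Side

  Z : Fin n → Bool
  Z v = zone left v ∨ zone right v

  -- M exceeds the whole ground weight L, and δ exceeds three times the ground weight N of the zones
  N δ : ℚ
  N = sumFin λ (_ : Fin n) → 1ℚ
  δ = ((N + N) + N) + 1ℚ

  ground : Fin n → ℚ
  ground v = if Z v then 1ℚ else δ

  L M MN SB : ℚ
  L  = sumFin ground
  M  = L + 1ℚ
  MN = M + N
  SB = N + (MN + MN)

  point : Fin n → ℚ → Fin n → ℚ
  point a c v = if ｛ a ｝ v then c else 0ℚ

  bonus : Side → Fin n → ℚ
  bonus σ v = point (p σ) M v + point (q σ) MN v

  w : Fin n → ℚ
  w v = ground v + (bonus left v + bonus right v)

  0<1 : 0ℚ < 1ℚ
  0<1 = ℚ.positive⁻¹ 1ℚ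

  <+1 : ∀ x → x < x + 1ℚ
  <+1 x = subst (_< x + 1ℚ) (ℚ.+-identityʳ x) (ℚ.+-monoʳ-< x 0<1)

  0≤N : 0ℚ ≤ N
  0≤N = subst (_≤ N) (sumFin-zero {n}) (sumFin-mono {n} λ _ → ℚ.<⇒≤ 0<1)

  N<δ : N < δ
  N<δ = ℚ.≤-<-trans (subst (N ≤_) (ℚ.+-comm N (N + N)) (p≤p+q N (ℚ.+-mono-≤ 0≤N 0≤N))) (<+1 _)

  ground>0 : ∀ v → 0ℚ < ground v
  ground>0 v with Z v
  ... | true  = 0<1
  ... | false = ℚ.≤-<-trans 0≤N N<δ

  ground≥0 : NonNegative ground
  ground≥0 = ℚ.<⇒≤ ∘ ground>0

  L<M : L < M
  L<M = <+1 L

  M≤MN : M ≤ MN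
  M≤MN = p≤p+q M 0≤N

  0≤M : 0ℚ ≤ M
  0≤M = ℚ.<⇒≤ (ℚ.≤-<-trans (Wt-nonNeg ground≥0 (λ _ → true)) L<M)

  0≤MN : 0ℚ ≤ MN
  0≤MN = ℚ.≤-trans 0≤M M≤MN

  open +-*-Solver

  SB<δ+2M : SB < δ + (M + M)
  SB<δ+2M = subst (SB <_) (solve 2 (λ N M → (N :+ ((M :+ N) :+ (M :+ N))) :+ con 1ℚ
                                             := (((N :+ N) :+ N) :+ con 1ℚ) :+ (M :+ M)) refl N M) (<+1 SB)

  point≥0 : ∀ a {c} → 0ℚ ≤ c → NonNegative (point a c)
  point≥0 a c≥0 v with ｛ a ｝ v
  ... | true  = c≥0
  ... | false = ℚ.≤-refl

  w>0 : PositiveWeight w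
  w>0 v = ℚ.<-≤-trans (ground>0 v) (subst (_≤ w v) (ℚ.+-identityʳ (ground v)) (ℚ.+-monoʳ-≤ (ground v)
            (ℚ.+-mono-≤ (bonus≥0 left) (bonus≥0 right))))
    where
    bonus≥0 : ∀ σ → 0ℚ ≤ bonus σ v
    bonus≥0 σ = ℚ.+-mono-≤ (point≥0 (p σ) 0≤M v) (point≥0 (q σ) 0≤MN v)

  w≥0 : NonNegative w
  w≥0 = ℚ.<⇒≤ ∘ w>0

  ite : Bool → ℚ → ℚ
  ite b c = if b then c else 0ℚ

  H : Side → (Fin n → Bool) → ℚ
  H σ P = ite (P (p σ)) M + ite (P (q σ)) MN

  Λ : (Fin n → Bool) → ℚ
  Λ = Wt ground

  W-split : ∀ P → Wt w P ≡ Λ P + (H left P + H right P)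
  W-split P = trans (Wt-+ ground _ P) (cong (Λ P +_) (trans (Wt-+ (bonus left) (bonus right) P) (cong₂ _+_ (H≡ left) (H≡ right))))
    where
    H≡ : ∀ σ → Wt (bonus σ) P ≡ H σ P
    H≡ σ = trans (Wt-+ _ _ P) (cong₂ _+_ (Wt-point-mass (p σ) M P) (Wt-point-mass (q σ) MN P))

  ite≥0 : ∀ b {c} → 0ℚ ≤ c → 0ℚ ≤ ite b c
  ite≥0 true  c≥0 = c≥0
  ite≥0 false _   = ℚ.≤-refl

  ite≤ : ∀ b {c} → 0ℚ ≤ c → ite b c ≤ c
  ite≤ true  _   = ℚ.≤-refl
  ite≤ false c≥0 = c≥0

  module _ (σ : Side) (P : Fin n → Bool) where

    H≥0 : 0ℚ ≤ H σ P
    H≥0 = ℚ.+-mono-≤ (ite≥0 (P (p σ)) 0≤M) (ite≥0 (P (q σ)) 0≤MN)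

    H≤ : H σ P ≤ M + MN
    H≤ = ℚ.+-mono-≤ (ite≤ (P (p σ)) 0≤M) (ite≤ (P (q σ)) 0≤MN)

    H-q : P (q σ) ≡ true → MN ≤ H σ P
    H-q Pq rewrite Pq = subst (_≤ ite (P (p σ)) M + MN) (ℚ.+-identityˡ MN) (ℚ.+-monoˡ-≤ MN (ite≥0 (P (p σ)) 0≤M))

    H-pq : P (p σ) ≡ true → P (q σ) ≡ true → M + MN ≤ H σ P
    H-pq Pp Pq rewrite Pp | Pq = ℚ.≤-refl

    H-p∨q : P (p σ) ≡ true ⊎ P (q σ) ≡ true → M ≤ H σ P
    H-p∨q (inj₁ Pp) rewrite Pp = p≤p+q M (ite≥0 (P (q σ)) 0≤MN)
    H-p∨q (inj₂ Pq) = ℚ.≤-trans M≤MN (H-q Pq)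

    H-¬q : P (q σ) ≡ false → H σ P ≤ M
    H-¬q ¬Pq rewrite ¬Pq = subst (_≤ M) (sym (ℚ.+-identityʳ _)) (ite≤ (P (p σ)) 0≤M)

    H-¬p : P (p σ) ≡ false → H σ P ≤ MN
    H-¬p ¬Pp rewrite ¬Pp = subst (_≤ MN) (sym (ℚ.+-identityˡ _)) (ite≤ (P (q σ)) 0≤MN)

    H-¬pq : ¬ (P (p σ) ≡ true × P (q σ) ≡ true) → H σ P ≤ MN
    H-¬pq ¬both with P (p σ) Bool.≟ true
    ... | yes Pp = ℚ.≤-trans (H-¬q (¬-not λ Pq → ¬both (Pp , Pq))) M≤MN
    ... | no ¬Pp = H-¬p (¬-not ¬Pp)

    H-none : P (p σ) ≡ false → P (q σ) ≡ false → H σ P ≤ 0ℚ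
    H-none ¬Pp ¬Pq rewrite ¬Pp | ¬Pq = ℚ.≤-refl

  Λ≥0 : ∀ P → 0ℚ ≤ Λ P
  Λ≥0 = Wt-nonNeg ground≥0

  Λ≤L : ∀ P → Λ P ≤ L
  Λ≤L P = Wt-mono ground≥0 {P} {λ _ → true} λ _ → refl

  Λ≤N : ∀ {P} → P ⊆ᵇ Z → Λ P ≤ N
  Λ≤N {P} P⊆Z = sumFin-mono term
    where
    term : ∀ v → (if P v then ground v else 0ℚ) ≤ 1ℚ
    term v with P v in Pv
    ... | false = ℚ.<⇒≤ 0<1
    ... | true rewrite P⊆Z Pv = ℚ.≤-refl

  δ≤Λ : ∀ P {r} → P r ≡ true → Z r ≡ false → δ ≤ Λ P
  δ≤Λ P {r} Pr ¬Zr = subst (_≤ Λ P) ground-r (≤-Wt ground≥0 {P} Pr)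
    where
    ground-r : ground r ≡ δ
    ground-r rewrite ¬Zr = refl

  S : Fin n → Bool
  S v = boundary left v ∨ boundary right v

  module Oriented (near far : Side) (near∩far=∅ : Disjointᵇ (zone near) (zone far))
    (near≁far : ∀ {u v} → zone near u ≡ true → zone far v ≡ true → ¬ E G u v)
    (near⊆Z : zone near ⊆ᵇ Z) (outside : ∀ {v} → zone near v ≡ false → zone far v ≡ false → Z v ≡ false)
    (boundary⊆S : boundary near ⊆ᵇ S) (split : ∀ P → Wt w P ≡ Λ P + (H near P + H far P)) where

    W≥ : ∀ P {a b c} → a ≤ Λ P → b ≤ H near P → c ≤ H far P → a + (b + c) ≤ Wt w P
    W≥ P a≤ b≤ c≤ = ℚ.≤-trans (ℚ.+-mono-≤ a≤ (ℚ.+-mono-≤ b≤ c≤)) (ℚ.≤-reflexive (sym (split P)))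

    W≤ : ∀ P {a b c} → Λ P ≤ a → H near P ≤ b → H far P ≤ c → Wt w P ≤ a + (b + c)
    W≤ P ≤a ≤b ≤c = ℚ.≤-trans (ℚ.≤-reflexive (split P)) (ℚ.+-mono-≤ ≤a (ℚ.+-mono-≤ ≤b ≤c))

    zone⁺ : ∀ {v} → inner near v ≡ true → zone near v ≡ true
    zone⁺ = ∨⁺ˡ _

    far∉ : ∀ {P : Fin n → Bool} → P ⊆ᵇ zone near → P (p far) ≡ false × P (q far) ≡ false
    far∉ P⊆ = ¬-not (λ h → near∩far=∅ (P⊆ h) (∨⁺ˡ _ (inner-p far)))
            , ¬-not (λ h → near∩far=∅ (P⊆ h) (∨⁺ʳ (inner far _) (boundary-q far)))

    inner-light : ∀ {D} → IsComponent G (∁ (tabulate S)) D → ∀ {d} → d ∈ D → inner near d ≡ true → wt w D ≤ MN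
    inner-light {D} D-comp d∈D inner-d =
      ℚ.≤-trans (W≤ (lookup D) (Λ≤N (near⊆Z ∘ zone⁺ ∘ D⊆inner)) (H-¬q near (lookup D) q∉D)
                               (H-none far (lookup D) (proj₁ (far∉ (zone⁺ ∘ D⊆inner))) (proj₂ (far∉ (zone⁺ ∘ D⊆inner)))))
                (ℚ.≤-reflexive (trans (cong (N +_) (ℚ.+-identityʳ M)) (ℚ.+-comm N M)))
      where
      ∉S : ∀ {v} → lookup (∁ (tabulate S)) v ≡ true → S v ≡ false
      ∉S {v} h = trans (sym (Vec.lookup∘tabulate S v)) (∁-false (tabulate S) h)
      closed : ClosedUnder (inner near) (lookup (∁ (tabulate S)))
      closed inner-u ∁Sv e with inner-closed near inner-u e
      ... | inj₁ inner-v    = inner-v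
      ... | inj₂ boundary-v = ⊥-elim (not-¬ (boundary⊆S boundary-v) (∉S ∁Sv))
      D⊆inner : lookup D ⊆ᵇ inner near
      D⊆inner Dv = component-within D-comp closed d∈D inner-d (lookup⇒∈ Dv)
      q∉D : lookup D (q near) ≡ false
      q∉D = ¬-not λ Dq → not-¬ (boundary⊆S (boundary-q near)) (∉S (component⊆ D-comp (lookup⇒∈ Dq)))

    -- the component of G − T through p and q of the near side weighs M + MN, more than T unless T holds the far pair
    missing-near : ∀ {T} → IsConnSafe G w T → lookup T (p near) ≡ false → lookup T (q near) ≡ false →
      ∀ {r} → lookup T r ≡ true → Z r ≡ false → SB < wt w T
    missing-near {T} (T-safe , _) ¬Tp ¬Tq {r} Tr ¬Zr with (lookup T (p far) Bool.≟ true) ×-dec (lookup T (q far) Bool.≟ true)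
    ... | yes (Tp′ , Tq′) =
      ℚ.<-≤-trans SB<δ+2M (ℚ.≤-trans (ℚ.+-monoʳ-≤ δ (subst (M + M ≤_) (sym (ℚ.+-identityˡ _)) (ℚ.+-monoʳ-≤ M M≤MN)))
                                     (W≥ (lookup T) (δ≤Λ (lookup T) Tr ¬Zr) (H≥0 near (lookup T)) (H-pq far (lookup T) Tp′ Tq′)))
    ... | no ¬far = decidable-stable (_ ℚ.<? _) do
      (D , D-comp , p∈D , D≤T) ← safe⇒light-component w≥0 connected T-safe ¬Tp
      let q∈D = component-reach D-comp p∈D (step (∁-true T ¬Tp) (pq near) (here (∁-true T ¬Tq)))
      pure (⊥-elim (ℚ.<-irrefl refl (begin-strict
        M + MN                     ≡⟨ sym (trans (ℚ.+-identityˡ _) (ℚ.+-identityʳ _)) ⟩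
        0ℚ + ((M + MN) + 0ℚ)       ≤⟨ W≥ (lookup D) (Λ≥0 (lookup D)) (H-pq near (lookup D) (∈⇒lookup p∈D) (∈⇒lookup q∈D))
                                         (H≥0 far (lookup D)) ⟩
        wt w D                     ≤⟨ D≤T ⟩
        wt w T                     ≤⟨ W≤ (lookup T) (Λ≤L (lookup T)) (H-none near (lookup T) ¬Tp ¬Tq) (H-¬pq far (lookup T) ¬far) ⟩
        L + (0ℚ + MN)              ≡⟨ cong (L +_) (ℚ.+-identityˡ MN) ⟩
        L + MN                     <⟨ ℚ.+-monoˡ-< MN L<M ⟩
        M + MN                     ∎)))
      where
      open ℚ.≤-Reasoning

    far-p : zone far (p far) ≡ true
    far-p = ∨⁺ˡ _ (inner-p far)

    -- the complement of a connected safe set inside the near side holds the far heavy pair and a vertex off both zones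
    inside-near : ∀ {T} → IsConnSafe G w T → lookup T ⊆ᵇ zone near → ⊥
    inside-near T-cs T⊆near =
      let (a , v , far-a , ¬far-v , av) = walk-exit (zone far) far-p (¬-not λ h → near∩far=∅ (zone⁺ (inner-p near)) h)
                                                    (proj₂ (connected (p far) (p near)))
      in around T-cs T⊆near far-a ¬far-v av
      where
      around : ∀ {T a v} → IsConnSafe G w T → lookup T ⊆ᵇ zone near → zone far a ≡ true → zone far v ≡ false → E G a v → ⊥
      around {T} {a} {v} (T-safe , _) T⊆near far-a ¬far-v av = decidable-stable (no λ ()) do
        (D , D-comp , p∈D , D≤T) ← safe⇒light-component w≥0 connected T-safe (far⊆∁T far-p)
        let in-D : ∀ {u} → zone far u ≡ true → lookup D u ≡ true
            in-D far-u = ∈⇒lookup (component-reach D-comp p∈D (path-map (∁-true T ∘ far⊆∁T) (zone-connected far far-p far-u)))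
        pure (ℚ.<-irrefl refl (begin-strict
          δ + (0ℚ + (M + MN))           ≤⟨ W≥ (lookup D) (δ≤Λ (lookup D) (v∈D D-comp (in-D far-a)) ¬Zv) (H≥0 near (lookup D))
                                               (H-pq far (lookup D) (in-D far-p) (in-D (∨⁺ʳ (inner far _) (boundary-q far)))) ⟩
          wt w D                        ≤⟨ D≤T ⟩
          wt w T                        ≤⟨ W≤ (lookup T) (Λ≤N (near⊆Z ∘ T⊆near)) (H≤ near (lookup T))
                                               (H-none far (lookup T) (proj₁ (far∉ T⊆near)) (proj₂ (far∉ T⊆near))) ⟩
          N + ((M + MN) + 0ℚ)           ≡⟨ cong (N +_) (ℚ.+-identityʳ _) ⟩
          N + (M + MN)                  <⟨ ℚ.+-monoˡ-< (M + MN) N<δ ⟩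
          δ + (M + MN)                  ≡⟨ cong (δ +_) (sym (ℚ.+-identityˡ _)) ⟩
          δ + (0ℚ + (M + MN))           ∎))
        where
        open ℚ.≤-Reasoning
        far⊆∁T : ∀ {u} → zone far u ≡ true → lookup T u ≡ false
        far⊆∁T far-u = ¬-not λ Tu → near∩far=∅ (T⊆near Tu) far-u
        ¬near-v : zone near v ≡ false
        ¬near-v = ¬-not λ near-v → near≁far near-v far-a (E-sym av)
        ¬Zv : Z v ≡ false
        ¬Zv = outside ¬near-v ¬far-v
        v∈D : ∀ {D} → IsComponent G (∁ T) D → lookup D a ≡ true → lookup D v ≡ true
        v∈D D-comp Da = ∈⇒lookup (component-reach D-comp (lookup⇒∈ Da)
                          (step (∁-true T (far⊆∁T far-a)) av (here (∁-true T (¬-not λ Tv → not-¬ (T⊆near Tv) ¬near-v)))))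

    boundary-heavy : ∀ {C} → IsComponent G (tabulate S) C → ∀ {c} → c ∈ C → boundary near c ≡ true → MN ≤ wt w C
    boundary-heavy {C} C-comp {c} c∈C boundary-c =
      ℚ.≤-trans (ℚ.≤-reflexive (sym (trans (ℚ.+-identityˡ _) (ℚ.+-identityʳ _))))
                (W≥ (lookup C) (Λ≥0 (lookup C)) (H-q near (lookup C) q∈C) (H≥0 far (lookup C)))
      where
      q∈C : lookup C (q near) ≡ true
      q∈C with c Fin.≟ q near
      ... | yes refl = ∈⇒lookup c∈C
      ... | no c≢q   = ∈⇒lookup (component-reach C-comp c∈C
                         (step (component⊆ C-comp c∈C) (boundary-clique near boundary-c (boundary-q near) c≢q)
                               (here (trans (Vec.lookup∘tabulate S _) (boundary⊆S (boundary-q near))))))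

  left⊆Z : zone left ⊆ᵇ Z
  left⊆Z = ∨⁺ˡ _

  right⊆Z : zone right ⊆ᵇ Z
  right⊆Z {v} = ∨⁺ʳ (zone left v)

  module Left = Oriented left right disjoint apart left⊆Z ∨-false⁺ (∨⁺ˡ _) W-split
  module Right = Oriented right left (λ h h′ → disjoint h′ h) (λ h h′ e → apart h′ h (E-sym e)) right⊆Z
    (λ ¬right ¬left → ∨-false⁺ ¬left ¬right) (λ {v} → ∨⁺ʳ (boundary left v))
    (λ P → trans (W-split P) (cong (Λ P +_) (ℚ.+-comm (H left P) (H right P))))

  S⊆Z : S ⊆ᵇ Z
  S⊆Z {v} h with ∨⁻ (boundary left v) h
  ... | inj₁ bl = left⊆Z (∨⁺ʳ (inner left v) bl)
  ... | inj₂ br = right⊆Z (∨⁺ʳ (inner right v) br)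

  S-light : Wt w S ≤ SB
  S-light = Left.W≤ S (Λ≤N S⊆Z) (H-¬p left S (∨-false⁺ ¬bl ¬br)) (H-¬p right S (∨-false⁺ ¬bl′ ¬br′))
    where
    ¬bl  = ¬-not λ h → inner∩boundary=∅ left (inner-p left) h
    ¬br  = ¬-not λ h → disjoint (∨⁺ˡ _ (inner-p left)) (∨⁺ʳ (inner right _) h)
    ¬bl′ = ¬-not λ h → disjoint (∨⁺ʳ (inner left _) h) (∨⁺ˡ _ (inner-p right))
    ¬br′ = ¬-not λ h → inner∩boundary=∅ right (inner-p right) h

  outer-light : ∀ {D} → IsComponent G (∁ (tabulate S)) D → ∀ {d} → d ∈ D → Z d ≡ false → wt w D ≤ MN
  outer-light {D} D-comp d∈D ¬Zd =
    ℚ.≤-trans (Left.W≤ (lookup D) (Λ≤L (lookup D))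
                (H-none left (lookup D) (off (left⊆Z (∨⁺ˡ _ (inner-p left)))) (off (left⊆Z (∨⁺ʳ (inner left _) (boundary-q left)))))
                (H-none right (lookup D) (off (right⊆Z (∨⁺ˡ _ (inner-p right))))
                                         (off (right⊆Z (∨⁺ʳ (inner right _) (boundary-q right))))))
              (ℚ.≤-trans (ℚ.≤-reflexive (trans (cong (L +_) (ℚ.+-identityʳ 0ℚ)) (ℚ.+-identityʳ L)))
                         (ℚ.<⇒≤ (ℚ.<-≤-trans L<M M≤MN)))
    where
    closed : ClosedUnder (not ∘ Z) (lookup (∁ (tabulate S)))
    closed {u} {v} ¬Zu ∁Sv e = cong not (¬-not λ Zv → not-¬ (escape Zv) (not-injective ¬Zu))
      where
      ¬Sv : S v ≡ false
      ¬Sv = trans (sym (Vec.lookup∘tabulate S v)) (∁-false (tabulate S) ∁Sv)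
      zone-escape : ∀ σ → zone σ ⊆ᵇ Z → boundary σ ⊆ᵇ S → zone σ v ≡ true → Z u ≡ true
      zone-escape σ σ⊆Z bσ⊆S zone-v with ∨⁻ (inner σ v) zone-v
      ... | inj₂ bv = ⊥-elim (not-¬ (bσ⊆S bv) ¬Sv)
      ... | inj₁ iv with inner-closed σ iv (E-sym e)
      ...   | inj₁ iu = σ⊆Z (∨⁺ˡ _ iu)
      ...   | inj₂ bu = σ⊆Z (∨⁺ʳ (inner σ u) bu)
      escape : Z v ≡ true → Z u ≡ true
      escape Zv with ∨⁻ (zone left v) Zv
      ... | inj₁ lv = zone-escape left left⊆Z (∨⁺ˡ _) lv
      ... | inj₂ rv = zone-escape right right⊆Z (λ {x} → ∨⁺ʳ (boundary left x)) rv
    off : ∀ {v} → Z v ≡ true → lookup D v ≡ false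
    off Zv = ¬-not λ Dv → not-¬ Zv (not-injective (component-within D-comp closed d∈D (cong not ¬Zd) (lookup⇒∈ Dv)))

  S-safe : IsSafe G w (tabulate S)
  S-safe = (q left , ∈-tabulate⁺ (∨⁺ˡ _ (boundary-q left))) , λ C D C-comp D-comp _ →
    ℚ.≤-trans (component-light D-comp) (component-heavy C-comp)
    where
    component-heavy : ∀ {C} → IsComponent G (tabulate S) C → MN ≤ wt w C
    component-heavy C-comp with proj₁ C-comp
    ... | c , c∈C with ∨⁻ (boundary left c) (∈-tabulate⁻ (proj₁ (proj₂ C-comp) c c∈C))
    ...   | inj₁ bl = Left.boundary-heavy C-comp c∈C bl
    ...   | inj₂ br = Right.boundary-heavy C-comp c∈C br
    component-light : ∀ {D} → IsComponent G (∁ (tabulate S)) D → wt w D ≤ MN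
    component-light D-comp with proj₁ D-comp
    ... | d , d∈D with inner left d Bool.≟ true | inner right d Bool.≟ true
    ...   | yes il | _      = Left.inner-light D-comp d∈D il
    ...   | no _   | yes ir = Right.inner-light D-comp d∈D ir
    ...   | no ¬il | no ¬ir
      with ∨-false⁻ {boundary left d} (trans (sym (Vec.lookup∘tabulate S d)) (∁-false (tabulate S) (component⊆ D-comp d∈D)))
    ...     | ¬bl , ¬br = outer-light D-comp d∈D (∨-false⁺ (∨-false⁺ (¬-not ¬il) ¬bl) (∨-false⁺ (¬-not ¬ir) ¬br))

  meets : ∀ σ (P : Fin n → Bool) → (P (p σ) ≡ true ⊎ P (q σ) ≡ true) ⊎ (P (p σ) ≡ false × P (q σ) ≡ false)
  meets σ P with P (p σ) Bool.≟ true | P (q σ) Bool.≟ true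
  ... | yes Pp | _      = inj₁ (inj₁ Pp)
  ... | no _   | yes Pq = inj₁ (inj₂ Pq)
  ... | no ¬Pp | no ¬Pq = inj₂ (¬-not ¬Pp , ¬-not ¬Pq)

  one-zone : ∀ {T} → Connectedᵇ T → ∀ {t₀} → T t₀ ≡ true → T ⊆ᵇ Z → T ⊆ᵇ zone left ⊎ T ⊆ᵇ zone right
  one-zone {T} T-conn {t₀} Tt₀ T⊆Z with ∨⁻ (zone left t₀) (T⊆Z Tt₀)
  ... | inj₁ lt₀ = inj₁ λ Tv → path-closed (λ lu Tv′ e → stay-left lu (T⊆Z Tv′) e) lt₀ (T-conn Tt₀ Tv)
    where
    stay-left : ∀ {u v} → zone left u ≡ true → Z v ≡ true → E G u v → zone left v ≡ true
    stay-left {v = v} lu Zv e with ∨⁻ (zone left v) Zv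
    ... | inj₁ lv = lv
    ... | inj₂ rv = ⊥-elim (apart lu rv e)
  ... | inj₂ rt₀ = inj₂ λ Tv → path-closed (λ ru Tv′ e → stay-right ru (T⊆Z Tv′) e) rt₀ (T-conn Tt₀ Tv)
    where
    stay-right : ∀ {u v} → zone right u ≡ true → Z v ≡ true → E G u v → zone right v ≡ true
    stay-right {v = v} ru Zv e with ∨⁻ (zone left v) Zv
    ... | inj₁ lv = ⊥-elim (apart lv ru (E-sym e))
    ... | inj₂ rv = rv

  S-lighter : ∀ {T} → IsConnSafe G w T → SB < wt w T
  S-lighter {T} T-cs with Fin.any? (λ r → (lookup T r Bool.≟ true) ×-dec (Z r Bool.≟ false))
  ... | yes (r , Tr , ¬Zr) with meets left (lookup T) | meets right (lookup T)
  ...   | inj₁ meets-left | inj₁ meets-right =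
          ℚ.<-≤-trans SB<δ+2M (Left.W≥ (lookup T) (δ≤Λ (lookup T) Tr ¬Zr) (H-p∨q left (lookup T) meets-left)
                                                                           (H-p∨q right (lookup T) meets-right))
  ...   | inj₂ (¬Tp , ¬Tq) | _ = Left.missing-near T-cs ¬Tp ¬Tq Tr ¬Zr
  ...   | _ | inj₂ (¬Tp , ¬Tq) = Right.missing-near T-cs ¬Tp ¬Tq Tr ¬Zr
  S-lighter {T} T-cs@((( t₀ , t₀∈T ) , _) , T-conn) | no ∄r with one-zone T-connected (∈⇒lookup t₀∈T) T⊆Z
    where
    T-connected : Connectedᵇ (lookup T)
    T-connected Ta Tb = fromPathIn (T-conn _ _ (lookup⇒∈ Ta) (lookup⇒∈ Tb))
    T⊆Z : lookup T ⊆ᵇ Z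
    T⊆Z {v} Tv = ¬-not λ ¬Zv → ∄r (v , Tv , ¬Zv)
  ... | inj₁ T⊆left  = ⊥-elim (Left.inside-near T-cs T⊆left)
  ... | inj₂ T⊆right = ⊥-elim (Right.inside-near T-cs T⊆right)

  everything-connected-safe : IsConnSafe G w (tabulate λ _ → true)
  everything-connected-safe = connected-safe w≥0 (λ _ → true) {p left} refl
    (λ {a} {b} _ _ → walk⇒path (proj₂ (connected a b)))
    λ D D-comp → let (d , d∈D) = proj₁ D-comp in
      ⊥-elim (not-¬ (Vec.lookup∘tabulate (λ _ → true) d) (∁-false (tabulate λ _ → true) {d} (component⊆ D-comp d∈D)))

  not-Gcs : ¬ InGcs G
  not-Gcs gcs = decidable-stable (no λ ()) do
      (s , s-min) ← ¬¬-min-weight w (IsSafe G w) (tabulate S , S-safe)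
      (cs , cs-min) ← ¬¬-min-weight w (IsConnSafe G w) (_ , everything-connected-safe)
      let (T , T-cs , T≡cs) = proj₁ cs-min
      pure (ℚ.<-irrefl (gcs w w>0 s cs s-min cs-min) (begin-strict
        s                 ≤⟨ proj₂ s-min (tabulate S) S-safe ⟩
        wt w (tabulate S) ≡⟨ Wt-tabulate w S ⟩
        Wt w S            ≤⟨ S-light ⟩
        SB                <⟨ S-lighter T-cs ⟩
        wt w T            ≡⟨ T≡cs ⟩
        cs                ∎))
    where
    open ℚ.≤-Reasoning

-- Y is the component of y outside the 3-ball around x, C its boundary; X is the component of x
-- outside the 3-ball around Y, A its boundary
module FarApart {n : ℕ} (G : Graph n) (connected : Connected G) (chordal : Chordal G)
  {x y : Fin n} (far : ¬ WithinDistance.Near G 3 x y)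
  (B₂ : Comprehension (WithinDistance.InBall G ｛ x ｝ 2)) (B₃ : Comprehension (WithinDistance.InBall G ｛ x ｝ 3))
  (Y : Comprehension (Graphs.Path G (not ∘ Comprehension.set B₃) y))
  (D₁ : Comprehension (WithinDistance.InBall G (Comprehension.set Y) 1))
  (D₂ : Comprehension (WithinDistance.InBall G (Comprehension.set Y) 2))
  (D₃ : Comprehension (WithinDistance.InBall G (Comprehension.set Y) 3))
  (X : Comprehension (Graphs.Path G (not ∘ Comprehension.set D₃) x)) where
  open Graphs G
  open WithinDistance G
  open ChordalGraphs G chordal
  open Separations G
  module B₂ = Comprehension B₂
  module B₃ = Comprehension B₃
  module Y = Comprehension Y
  module D₁ = Comprehension D₁
  module D₂ = Comprehension D₂
  module D₃ = Comprehension D₃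
  module X = Comprehension X

  C A : Fin n → Bool
  C v = not (Y.set v) ∧ attached Y.set v
  A v = not (X.set v) ∧ attached X.set v

  Y∩B₃=∅ : ∀ {v} → Y.set v ≡ true → B₃.set v ≡ false
  Y∩B₃=∅ Yv = not-injective (reach⊆ Y Yv)

  X∩D₃=∅ : ∀ {v} → X.set v ≡ true → D₃.set v ≡ false
  X∩D₃=∅ Xv = not-injective (reach⊆ X Xv)

  Yy : Y.set y ≡ true
  Yy = Y.complete (here (cong not (¬-not λ B₃y →
         far (let (c₀ , x≡c₀ , x⇝y) = B₃.sound B₃y in subst (λ c → Near 3 c y) (｛｝-sound x≡c₀) x⇝y))))

  Xx : X.set x ≡ true
  Xx = X.complete (here (cong not (¬-not λ D₃x → let (c₀ , Yc₀ , c₀⇝x) = D₃.sound D₃x in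
         not-¬ (B₃.complete (x , ｛｝-self x , near-reverse c₀⇝x)) (Y∩B₃=∅ Yc₀))))

  component-side : ∀ {K F} → Connectedᵇ K → K ⊆ᵇ F → (∀ {u v} → K u ≡ true → E G u v → F v ≡ true) →
    (∀ {v} → F v ≡ true → K v ≡ false → NeighbourIn K v) →
    ∀ {z t} (Q : Comprehension (Path (not ∘ F) z)) → Comprehension.set Q z ≡ true → Comprehension.set Q t ≡ false → Side
  component-side {K} {F} K-conn K⊆F K-step F-exact {z} {t} Q Qz ¬Qt =
    let (p , q , Qp , ¬Qq , pq) = walk-exit Q.set Qz ¬Qt (proj₂ (connected z t)) in record
      { inner            = Q.set
      ; boundary         = boundary
      ; p                = p
      ; q                = q
      ; inner-p          = Qp
      ; boundary-q       = ∧⁺ (cong not ¬Qq) (attached⁺ Qp (E-sym pq))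
      ; pq               = pq
      ; inner∩boundary=∅ = λ Qv bv → not-¬ Qv (not-injective (proj₁ (∧⁻ bv)))
      ; boundary-clique  = boundary-clique K-conn K⊆F K-step F-exact Q
      ; inner-closed     = inner-closed
      ; zone-connected   = rooted⇒connected from-z
      }
    where
    module Q = Comprehension Q
    boundary : Fin n → Bool
    boundary v = not (Q.set v) ∧ attached Q.set v
    inner-closed : ∀ {u v} → Q.set u ≡ true → E G u v → Q.set v ≡ true ⊎ boundary v ≡ true
    inner-closed {u} {v} Qu e with Q.set v Bool.≟ true
    ... | yes Qv = inj₁ Qv
    ... | no ¬Qv = inj₂ (∧⁺ (cong not (¬-not ¬Qv)) (attached⁺ Qu (E-sym e)))
    to-inner : ∀ {v} → Q.set v ≡ true → Path (λ v → Q.set v ∨ boundary v) z v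
    to-inner Qv = path-map (∨⁺ˡ _) (reach-connected Q Qz Qv)
    from-z : ∀ {v} → (Q.set v ∨ boundary v) ≡ true → Path (λ v → Q.set v ∨ boundary v) z v
    from-z {v} h with ∨⁻ (Q.set v) h
    ... | inj₁ Qv = to-inner Qv
    ... | inj₂ bv = let (u , Qu , vu) = attached⁻ (proj₂ (∧⁻ bv)) in path-snoc (to-inner Qu) (E-sym vu) h

  x-side y-side : Side
  x-side = component-side (ball-connected D₂ (reach-connected Y)) (ball-mono D₂ D₃) (ball-step D₂ D₃) (ball-exact D₂ D₃)
             {t = y} X Xx (¬-not λ Xy → not-¬ (ball-centre D₃ Yy) (X∩D₃=∅ Xy))
  y-side = component-side (ball-connected B₂ ｛x｝-connected) (ball-mono B₂ B₃) (ball-step B₂ B₃) (ball-exact B₂ B₃)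
             {t = x} Y Yy (¬-not λ Yx → not-¬ (ball-centre B₃ (｛｝-self x)) (Y∩B₃=∅ Yx))
    where
    ｛x｝-connected : Connectedᵇ ｛ x ｝
    ｛x｝-connected {a} xa xb = subst (Path ｛ x ｝ a) (trans (｛｝-sound xa) (sym (｛｝-sound xb))) (here xa)

  y-zone⊆D₁ : Side.zone y-side ⊆ᵇ D₁.set
  y-zone⊆D₁ {v} h with ∨⁻ (Y.set v) h
  ... | inj₁ Yv = ball-centre D₁ Yv
  ... | inj₂ Cv = let (u , Yu , vu) = attached⁻ (proj₂ (∧⁻ Cv)) in D₁.complete (u , Yu , near-edge (E-sym vu))

  x-zone∩D₂=∅ : ∀ {v} → Side.zone x-side v ≡ true → D₂.set v ≡ false
  x-zone∩D₂=∅ {v} h with ∨⁻ (X.set v) h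
  ... | inj₁ Xv = ¬-not λ D₂v → not-¬ (ball-mono D₂ D₃ D₂v) (X∩D₃=∅ Xv)
  ... | inj₂ Av =
    let (u , Xu , vu) = attached⁻ (proj₂ (∧⁻ Av)) in ¬-not λ D₂v → not-¬ (ball-step D₂ D₃ D₂v vu) (X∩D₃=∅ Xu)

  separation : Separation
  separation = record
    { left     = x-side
    ; right    = y-side
    ; disjoint = λ hx hy → not-¬ (ball-mono D₁ D₂ (y-zone⊆D₁ hy)) (x-zone∩D₂=∅ hx)
    ; apart    = λ hx hy e → not-¬ (ball-step D₁ D₂ (y-zone⊆D₁ hy) (E-sym e)) (x-zone∩D₂=∅ hx)
    }

Gcs⇒diam≤3 : ∀ {n} (G : Graph n) → Connected G → Chordal G → InGcs G → DiamAtMost3 G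
Gcs⇒diam≤3 G connected chordal gcs x y = decidable-stable (near? 3 x y) λ far → decidable-stable (no λ ()) do
    B₂ ← ¬¬-comprehension (InBall ｛ x ｝ 2)
    B₃ ← ¬¬-comprehension (InBall ｛ x ｝ 3)
    Y  ← ¬¬-comprehension (Path (not ∘ Comprehension.set B₃) y)
    D₁ ← ¬¬-comprehension (InBall (Comprehension.set Y) 1)
    D₂ ← ¬¬-comprehension (InBall (Comprehension.set Y) 2)
    D₃ ← ¬¬-comprehension (InBall (Comprehension.set Y) 3)
    X  ← ¬¬-comprehension (Path (not ∘ Comprehension.set D₃) x)
    pure (SeparationWeights.not-Gcs G connected (FarApart.separation G connected chordal far B₂ B₃ Y D₁ D₂ D₃ X) gcs)
  where
  open Graphs G
  open WithinDistance G

theorem1p3 : ∀ {n : ℕ} (G : Graph n) → Connected G → Chordal G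
    → ((HasDominatingClique G ⇔ DiamAtMost3 G) × (DiamAtMost3 G ⇔ InGcs G))
theorem1p3 G connected chordal =
    mk⇔ (dominating-clique⇒diam≤3 G) diam≤3⇒dominating-clique
  , mk⇔ (dominating-clique⇒Gcs G chordal ∘ diam≤3⇒dominating-clique) (Gcs⇒diam≤3 G connected chordal)
  where
  open GrowingCliques G connected chordal using (diam≤3⇒dominating-clique)
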